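{- Let $Z$ be a zipper gadget of size $n\ge 1$ and skew $s\ge 0$ with paths $P,Q$. For every properly multicolored triangulation of $Z$ there is an offset $\Delta\in\{0,1,\dots,s\}$ such that for every $i\in\{1,\dots,n\}$ the $i$-th tooth of $P$ is locked together with the $(i+\Delta)$-th tooth of $Q$ and with no other tooth of $Q$; and conversely, for every $\Delta\in\{0,1,\dots,s\}$ there exists a properly multicolored triangulation of $Z$ with this offset. Thus $Z$ has exactly $s+1$ ways to be triangulated, identified by the offset at which the teeth lock together.
   Context: A multicolored graph assigns each vertex a set of colors; it is properly multicolored if no edge joins two vertices sharing a color. A triangulation of $Z$ is a supergraph on the same vertex set with the same multicoloring in which every cycle of length at least four has a chord. A zipper gadget of size $n$ and skew $s$ consists of a path $P=p_1\cdots p_{4n-1}$, a path $Q=q_1\cdots q_{4(n+s)}$ (vertex-disjoint), a head $h$ adjacent to $p_1$ and $q_1$, and a tail $t$ adjacent to $p_{4n-1}$ and $q_{4(n+s)}$ (so the whole gadget is a cycle). Colors: $h$ and $t$ have only color $b_P$; $p_j$ has color $a$ if $j$ is odd and $b_P$ if $j$ is even; $q_j$ has $a$ if $j$ is even and $b_Q$ if $j$ is odd; additionally $p_j$ has $c_i$ where $j\equiv i\pmod 4$ and $q_j$ has $c_i$ where $j\equiv i+2 \pmod 4$, $i\in\{1,2,3,4\}$. The $i$-th tooth of $P$ is $\{p_{4i-3},\dots,p_{4i}\}\cap V(P)$ (so $P$ has $n$ teeth, the last missing one vertex), and the $i$-th tooth of $Q$ is $\{q_{4i-3},\dots,q_{4i}\}$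 ($n+s$ teeth). In a triangulation, a tooth of $P$ and a tooth of $Q$ are locked together if there is an edge between a vertex of the one and a vertex of the other with at least one endpoint having color $a$. -}

module Defs where

open import Data.Nat using (ℕ; zero; suc; _+_; _*_; _∸_; _≤_; _<_; _%_; _/_; _≡ᵇ_)
open import Data.Nat.DivMod using (_mod_)
open import Data.Nat.Properties using (_<?_)
open import Data.Fin using (Fin; toℕ; fromℕ<) renaming (zero to fzero)
open import Data.Bool using (Bool; true; false; if_then_else_; T)
open import Data.List using (List; []; _∷_)
open import Data.List.Membership.Propositional using (_∈_)
open import Data.Product using (Σ; ∃; ∃-syntax; _×_; _,_)
open import Data.Sum using (_⊎_)
open import Data.Empty using (⊥)
open import Relation.Nullary using (¬_; yes; no)
open import Relation.Binary.PropositionalEquality using (_≡_; _≢_)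
open import Function.Definitions using (Injective)

-- Vertices of the zipper gadget of size n and skew s.
--   h, t             : head and tail
--   p k  (k < 4n-1)  : the vertex p_{k+1} of P
--   q k  (k < 4(n+s)): the vertex q_{k+1} of Q

data V (n s : ℕ) : Set where
  h : V n s
  t : V n s
  p : Fin (4 * n ∸ 1) → V n s
  q : Fin (4 * (n + s)) → V n s

-- Colours.  c k (k : Fin 4) stands for the paper's colour c_{k+1}.
data Color : Set where
  a  : Color
  bP : Color
  bQ : Color
  c  : Fin 4 → Color

isEven : ℕ → Bool
isEven m = (m % 2) ≡ᵇ 0

-- For p_j (j = k+1): a if j odd, b_P if j even,
-- and c_i with i ≡ j (mod 4), i.e. c (k mod 4).
-- For q_j (j = k+1): a if j even, b_Q if j odd, and c_i with j ≡ i+2 (mod 4),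
-- i.e. i-1 ≡ j+1 ≡ k+2 (mod 4), i.e. c ((k+2) mod 4).
colors : ∀ {n s} → V n s → List Color
colors h = bP ∷ []
colors t = bP ∷ []
colors (p k) = (if isEven (toℕ k) then a else bP) ∷ c (toℕ k mod 4) ∷ []
colors (q k) = (if isEven (toℕ k) then bQ else a) ∷ c ((toℕ k + 2) mod 4) ∷ []

HasColor : ∀ {n s} → V n s → Color → Set
HasColor v col = col ∈ colors v

-- Edges of the zipper gadget Z (one orientation each).
data GadgetEdge {n s : ℕ} : V n s → V n s → Set where
  pp : (k k' : Fin (4 * n ∸ 1)) → toℕ k' ≡ suc (toℕ k) → GadgetEdge (p k) (p k')
  qq : (k k' : Fin (4 * (n + s))) → toℕ k' ≡ suc (toℕ k) → GadgetEdge (q k) (q k')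
  hp : (k : Fin (4 * n ∸ 1)) → toℕ k ≡ 0 → GadgetEdge h (p k)
  hq : (k : Fin (4 * (n + s))) → toℕ k ≡ 0 → GadgetEdge h (q k)
  tp : (k : Fin (4 * n ∸ 1)) → suc (toℕ k) ≡ 4 * n ∸ 1 → GadgetEdge t (p k)
  tq : (k : Fin (4 * (n + s))) → suc (toℕ k) ≡ 4 * (n + s) → GadgetEdge t (q k)

next : ∀ {m} → Fin (suc m) → Fin (suc m)
next {m} i with suc (toℕ i) <? suc m
... | yes lt = fromℕ< lt
... | no _  = fzero

IsCycle : ∀ {X : Set} → (X → X → Bool) → (m : ℕ) → (Fin (4 + m) → X) → Set
IsCycle adj m cyc = Injective _≡_ _≡_ cyc × (∀ i → T (adj (cyc i) (cyc (next i))))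

HasChord : ∀ {X : Set} → (X → X → Bool) → (m : ℕ) → (Fin (4 + m) → X) → Set
HasChord adj m cyc =
  ∃[ i ] ∃[ j ] (T (adj (cyc i) (cyc j)) × i ≢ j × j ≢ next i × i ≢ next j)

Chordal : ∀ {X : Set} → (X → X → Bool) → Set
Chordal adj = ∀ (m : ℕ) (cyc : Fin (4 + m) → _) → IsCycle adj m cyc → HasChord adj m cyc

record Triangulation (n s : ℕ) : Set where
  field
    adj     : V n s → V n s → Bool
    symm    : ∀ u v → adj u v ≡ adj v u
    irrefl  : ∀ v → adj v v ≡ false
    super   : ∀ u v → GadgetEdge u v → T (adj u v)
    chordal : Chordal adj
open Triangulation public

ProperlyMulticolored : ∀ {n s} → Triangulation n s → Set
ProperlyMulticolored {n} {s} G =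
  ∀ (u v : V n s) → T (adj G u v) → ∀ col → HasColor u col → HasColor v col → ⊥

-- Teeth (1-indexed, as in the paper).
-- The i-th tooth of P is {p_{4i-3},…,p_{4i}} ∩ V(P); p_{k+1} lies in tooth
-- i iff k / 4 + 1 ≡ i.  Similarly for Q.
InToothP : ∀ {n s} → ℕ → V n s → Set
InToothP i (p k) = suc (toℕ k / 4) ≡ i
InToothP i _ = ⊥

InToothQ : ∀ {n s} → ℕ → V n s → Set
InToothQ j (q k) = suc (toℕ k / 4) ≡ j
InToothQ j _ = ⊥

Locked : ∀ {n s} → Triangulation n s → ℕ → ℕ → Set
Locked {n} {s} G i j =
  ∃[ u ] ∃[ v ] (InToothP {n} {s} i u × InToothQ j v × T (adj G u v)
                 × (HasColor u a ⊎ HasColor v a))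

HasOffset : ∀ {n s} → Triangulation n s → ℕ → Set
HasOffset {n} {s} G Δ =
  ∀ i → 1 ≤ i → i ≤ n →
    Locked G i (i + Δ) × (∀ j → 1 ≤ j → j ≤ n + s → Locked G i j → j ≡ i + Δ)

-- The colours forbid chords inside P ∪ {t} and inside Q, so a chordal supergraph
-- can only triangulate the gadget's cycle by rungs between P and Q, arranged
-- like a ladder: the apex over the edge h p₁ is a first rung p₁ q_{4Δ+1}, and the
-- apex of the cycle closed by any rung is the next rung, one step further along P
-- or along Q. The colours c_i forbid rungs p_k q_l with l - k ≡ 2 (mod 4), so
-- along the ladder p_k stays within distance one of q_{4Δ+k}; with parity (colour
-- a) this pins every rung with an a-coloured end to p_k q_{4Δ+k}, and by the fan
-- and corner arguments below no other such rung exists. Conversely, for every Δ ≤ s these rungs,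
-- with fans at the head and the tail, form a chordal graph: q₁ … q_{4Δ} h p₁
-- q_{4Δ+1} q_{4Δ+2} p₂ p₃ q_{4Δ+3} … t is a perfect elimination ordering, and
-- every vertex has at most two later neighbours, each sharing no colour with it.

module Submission where

open import Defs
open import Data.Nat
open import Data.Nat.Properties
open import Data.Nat.DivMod
open import Data.Nat.Divisibility using (divides)
open import Data.Nat.Induction using (<-rec)
open import Data.Nat.Tactic.RingSolver
open import Data.Fin using (Fin; toℕ; fromℕ; fromℕ<; inject₁) renaming (zero to fzero; suc to fsuc; _≟_ to _≟ᶠ_)
open import Data.Fin.Properties using (toℕ-fromℕ<; toℕ-injective; toℕ<n; toℕ-fromℕ; toℕ-inject₁; fromℕ<-cong; fromℕ<-injective)
open import Data.Bool using (Bool; true; false; T; if_then_else_)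
open import Data.Bool.Properties using (T-≡; ⇔→≡)
open import Data.List.Relation.Unary.Any using (here; there)
open import Data.Product
open import Data.Sum
open import Data.Empty
open import Function using (_∘′_; case_of_)
open import Function.Bundles using (mk⇔; Equivalence)
open import Relation.Nullary
open import Relation.Nullary.Decidable using (⌊_⌋; toWitness; fromWitness; ¬?; _×-dec_; _⊎-dec_)
open import Relation.Binary using (tri<; tri≈; tri>)
open import Relation.Binary.PropositionalEquality

-- Paths and cycles in chordal graphs

Follows : ℕ → ℕ → ℕ → Set
Follows N x y = (x < N × y ≡ suc x) ⊎ (x ≡ N × y ≡ 0)

toℕ-next : ∀ {N} (i : Fin (suc N)) → Follows N (toℕ i) (toℕ (next i))
toℕ-next {N} i with suc (toℕ i) <? suc N
... | yes lt = inj₁ (≤-pred lt , toℕ-fromℕ< lt)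
... | no nlt = inj₂ (≤-antisym (≤-pred (toℕ<n i)) (≮⇒≥ (nlt ∘′ s≤s)) , refl)

follows-≢ : ∀ {N x y} → Follows N x y → 1 ≤ N → x ≢ y
follows-≢ (inj₁ (_ , refl))    _   = 1+n≢n ∘′ sym
follows-≢ (inj₂ (refl , refl)) 1≤N = λ N≡0 → <-irrefl (sym N≡0) 1≤N

follows²-≢ : ∀ {N x₀ x₁ x₂} → Follows N x₀ x₁ → Follows N x₁ x₂ → 2 ≤ N → x₀ ≢ x₂
follows²-≢ (inj₁ (_ , refl))    (inj₁ (_ , refl))    _              ()
follows²-≢ (inj₁ (_ , refl))    (inj₂ (refl , refl)) (s≤s (s≤s _))  ()
follows²-≢ (inj₂ (refl , refl)) (inj₁ (_ , refl))    (s≤s (s≤s _))  ()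
follows²-≢ (inj₂ (refl , refl)) (inj₂ (refl , refl)) ()

follows³-≢ : ∀ {N x₀ x₁ x₂ x₃} → Follows N x₀ x₁ → Follows N x₁ x₂ → Follows N x₂ x₃ → 3 ≤ N → x₀ ≢ x₃
follows³-≢ (inj₁ (_ , refl))    (inj₁ (_ , refl))    (inj₁ (_ , refl))    _                    ()
follows³-≢ (inj₁ (_ , refl))    (inj₁ (_ , refl))    (inj₂ (refl , refl)) (s≤s (s≤s (s≤s _))) ()
follows³-≢ (inj₁ (_ , refl))    (inj₂ (refl , refl)) (inj₁ (_ , refl))    (s≤s (s≤s (s≤s _))) ()
follows³-≢ (inj₁ (_ , refl))    (inj₂ (refl , refl)) (inj₂ (() , _))
follows³-≢ (inj₂ (refl , refl)) (inj₁ (_ , refl))    (inj₁ (_ , refl))    (s≤s (s≤s (s≤s _))) ()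
follows³-≢ (inj₂ (refl , refl)) (inj₁ (_ , refl))    (inj₂ (refl , refl)) (s≤s ())
follows³-≢ (inj₂ (refl , refl)) (inj₂ (refl , refl)) _                    ()

next-surjective : ∀ {m} (i : Fin (suc m)) → ∃[ j ] (next j ≡ i)
next-surjective {m} fzero with toℕ-next (fromℕ m)
... | inj₁ (lt , _) = ⊥-elim (<-irrefl (toℕ-fromℕ m) lt)
... | inj₂ (_ , eq) = fromℕ m , toℕ-injective eq
next-surjective {suc m} (fsuc i) with toℕ-next (inject₁ i)
... | inj₁ (_ , eq) = inject₁ i , toℕ-injective (trans eq (cong suc (toℕ-inject₁ i)))
... | inj₂ (eq , _) = ⊥-elim (<-irrefl (trans (sym (toℕ-inject₁ i)) eq) (≤-pred (toℕ<n (fsuc i))))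

jump : ℕ → ℕ → ℕ → ℕ
jump zero    d zero    = zero
jump zero    d (suc x) = suc (x + d)
jump (suc k) d zero    = zero
jump (suc k) d (suc x) = suc (jump k d x)

jump-≤ : ∀ k d x → x ≤ k → jump k d x ≡ x
jump-≤ zero    d zero    _         = refl
jump-≤ (suc k) d zero    _         = refl
jump-≤ (suc k) d (suc x) (s≤s x≤k) = cong suc (jump-≤ k d x x≤k)

jump-> : ∀ k d x → k < x → jump k d x ≡ x + d
jump-> zero    d (suc x) _         = refl
jump-> (suc k) d (suc x) (s≤s k<x) = cong suc (jump-> k d x k<x)

jump-mono-< : ∀ k d {x y} → x < y → jump k d x < jump k d y
jump-mono-< zero    d {zero}  {suc y} _         = z<s
jump-mono-< zero    d {suc x} {suc y} (s≤s x<y) = s≤s (+-monoˡ-< d x<y)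
jump-mono-< (suc k) d {zero}  {suc y} _         = z<s
jump-mono-< (suc k) d {suc x} {suc y} (s≤s x<y) = s≤s (jump-mono-< k d x<y)

jump-mono-≤ : ∀ k d {x y} → x ≤ y → jump k d x ≤ jump k d y
jump-mono-≤ k d x≤y with m≤n⇒m<n∨m≡n x≤y
... | inj₁ x<y  = <⇒≤ (jump-mono-< k d x<y)
... | inj₂ refl = ≤-refl

jump-injective : ∀ k d {x y} → jump k d x ≡ jump k d y → x ≡ y
jump-injective k d {x} {y} eq with <-cmp x y
... | tri< x<y _ _ = ⊥-elim (<-irrefl eq (jump-mono-< k d x<y))
... | tri≈ _ x≡y _ = x≡y
... | tri> _ _ y<x = ⊥-elim (<-irrefl (sym eq) (jump-mono-< k d y<x))

≤-jump : ∀ k d x → x ≤ jump k d x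
≤-jump zero    d zero    = z≤n
≤-jump zero    d (suc x) = s≤s (m≤m+n x d)
≤-jump (suc k) d zero    = z≤n
≤-jump (suc k) d (suc x) = s≤s (≤-jump k d x)

chord-positions : ∀ {N} (i j : Fin (suc N)) → toℕ i < toℕ j → j ≢ next i → i ≢ next j →
  ∃[ e ] ∃[ r ] (toℕ j ≡ toℕ i + suc (suc e) × N ≡ toℕ j + r × (toℕ i ≢ 0 ⊎ r ≢ 0))
chord-positions {N} i j i<j j≢i⁺ i≢j⁺ with m≤n⇒m<n∨m≡n i<j
... | inj₂ j≡i+1 with toℕ-next i
...   | inj₁ (_ , eq)  = ⊥-elim (j≢i⁺ (toℕ-injective (trans (sym j≡i+1) (sym eq))))
...   | inj₂ (i≡N , _) = ⊥-elim (<-irrefl i≡N (<-≤-trans i<j (≤-pred (toℕ<n j))))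
chord-positions {N} i j i<j j≢i⁺ i≢j⁺ | inj₁ i+1<j
  with e , i+2+e≡j ← m≤n⇒∃[o]m+o≡n i+1<j
     | r , j+r≡N ← m≤n⇒∃[o]m+o≡n (≤-pred (toℕ<n j)) =
  e , r , trans (sym i+2+e≡j) (reassoc (toℕ i) e) , sym j+r≡N , not-closing
  where
  reassoc : ∀ x e → suc (suc x) + e ≡ x + suc (suc e)
  reassoc = solve-∀
  not-closing : toℕ i ≢ 0 ⊎ r ≢ 0
  not-closing with toℕ i ≟ 0 | r ≟ 0
  ... | no i≢0 | _      = inj₁ i≢0
  ... | yes _  | no r≢0 = inj₂ r≢0
  ... | yes i≡0 | yes refl with toℕ-next j
  ...   | inj₁ (j<N , _) = ⊥-elim (<-irrefl (trans (sym (+-identityʳ _)) j+r≡N) j<N)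
  ...   | inj₂ (_ , eq)  = ⊥-elim (i≢j⁺ (toℕ-injective (trans i≡0 (sym eq))))

module Paths {X : Set} (adj : X → X → Bool) (adj-sym : ∀ u v → adj u v ≡ adj v u) where

  infix 4 _~_
  _~_ : X → X → Set
  u ~ v = T (adj u v)

  ~-sym : ∀ {u v} → u ~ v → v ~ u
  ~-sym {u} {v} = subst T (adj-sym u v)

  InjectiveOn : ℕ → (ℕ → X) → Set
  InjectiveOn r f = ∀ i j → i ≤ r → j ≤ r → f i ≡ f j → i ≡ j

  Walk : ℕ → (ℕ → X) → Set
  Walk r f = ∀ i → i < r → f i ~ f (suc i)

  -- The path f 0, …, f r: r + 1 vertices and r edges.
  record IsPath (r : ℕ) (f : ℕ → X) : Set where
    field
      injective : InjectiveOn r f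
      walk      : Walk r f

  record ClosedPath (r : ℕ) (f : ℕ → X) : Set where
    field
      path    : IsPath r f
      closing : f 0 ~ f r
    open IsPath path public

  record ChordlessPath (r : ℕ) (f : ℕ → X) : Set where
    field
      path      : IsPath r f
      chordless : ∀ i j → j ≤ r → 2 + i ≤ j → ¬ f i ~ f j
    open IsPath path public

  Apex : ℕ → (ℕ → X) → Set
  Apex r f = ∃[ m ] (0 < m × m < r × f 0 ~ f m × f m ~ f r)

  append : ℕ → (ℕ → X) → (ℕ → X) → ℕ → X
  append zero    f g zero    = f 0
  append zero    f g (suc z) = g z
  append (suc d) f g zero    = f 0
  append (suc d) f g (suc z) = append d (λ w → f (suc w)) g z

  append-≤ : ∀ d f g z → z ≤ d → append d f g z ≡ f z
  append-≤ zero    f g zero    _         = refl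
  append-≤ (suc d) f g zero    _         = refl
  append-≤ (suc d) f g (suc z) (s≤s z≤d) = append-≤ d (λ w → f (suc w)) g z z≤d

  append-> : ∀ d f g w → append d f g (suc (d + w)) ≡ g w
  append-> zero    f g w = refl
  append-> (suc d) f g w = append-> d (λ w → f (suc w)) g w

  ≤⊎>-split : ∀ d z → z ≤ d ⊎ ∃[ w ] (z ≡ suc (d + w))
  ≤⊎>-split d z with z ≤? d
  ... | yes z≤d = inj₁ z≤d
  ... | no z≰d  = let w , d+1+w≡z = m≤n⇒∃[o]m+o≡n (≰⇒> z≰d) in inj₂ (w , sym d+1+w≡z)

  IsPath-append : ∀ {d e f g} → IsPath d f → IsPath e g →
    (∀ z w → z ≤ d → w ≤ e → f z ≢ g w) → f d ~ g 0 → IsPath (suc (d + e)) (append d f g)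
  IsPath-append {d} {e} {f} {g} f-path g-path disjoint link = record { injective = injective ; walk = walk }
    where
    module f = IsPath f-path
    module g = IsPath g-path
    injective : InjectiveOn (suc (d + e)) (append d f g)
    injective z z′ z≤ z′≤ eq with ≤⊎>-split d z | ≤⊎>-split d z′
    ... | inj₁ z≤d | inj₁ z′≤d =
      f.injective z z′ z≤d z′≤d (trans (sym (append-≤ d f g z z≤d)) (trans eq (append-≤ d f g z′ z′≤d)))
    ... | inj₁ z≤d | inj₂ (w , refl) =
      ⊥-elim (disjoint z w z≤d (+-cancelˡ-≤ d _ _ (≤-pred z′≤)) (trans (sym (append-≤ d f g z z≤d)) (trans eq (append-> d f g w))))
    ... | inj₂ (w , refl) | inj₁ z′≤d =
      ⊥-elim (disjoint z′ w z′≤d (+-cancelˡ-≤ d _ _ (≤-pred z≤)) (trans (sym (append-≤ d f g z′ z′≤d)) (trans (sym eq) (append-> d f g w))))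
    ... | inj₂ (w , refl) | inj₂ (w′ , refl) =
      cong (λ u → suc (d + u)) (g.injective w w′ (+-cancelˡ-≤ d _ _ (≤-pred z≤)) (+-cancelˡ-≤ d _ _ (≤-pred z′≤))
        (trans (sym (append-> d f g w)) (trans eq (append-> d f g w′))))
    walk : Walk (suc (d + e)) (append d f g)
    walk z z< with ≤⊎>-split d z
    ... | inj₂ (w , refl) =
      subst₂ _~_ (sym (append-> d f g w)) (sym (trans (cong (λ u → append d f g (suc u)) (sym (+-suc d w))) (append-> d f g (suc w))))
        (g.walk w (+-cancelˡ-< d _ _ (≤-pred z<)))
    ... | inj₁ z≤d with m≤n⇒m<n∨m≡n z≤d
    ...   | inj₁ z<d  = subst₂ _~_ (sym (append-≤ d f g z z≤d)) (sym (append-≤ d f g (suc z) z<d)) (f.walk z z<d)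
    ...   | inj₂ refl =
      subst₂ _~_ (sym (append-≤ z f g z z≤d)) (sym (trans (cong (λ u → append z f g (suc u)) (sym (+-identityʳ z))) (append-> z f g 0))) link

  ClosedPath-append : ∀ {d e f g} → IsPath d f → IsPath e g →
    (∀ z w → z ≤ d → w ≤ e → f z ≢ g w) → f d ~ g 0 → g e ~ f 0 → ClosedPath (suc (d + e)) (append d f g)
  ClosedPath-append {d} {e} {f} {g} f-path g-path disjoint link back = record
    { path    = IsPath-append f-path g-path disjoint link
    ; closing = subst₂ _~_ (sym (append-≤ d f g 0 z≤n)) (sym (append-> d f g e)) (~-sym back)
    }

  IsPath-point : ∀ v → IsPath 0 (λ _ → v)
  IsPath-point v = record { injective = λ { 0 0 _ _ _ → refl } ; walk = λ _ () }

  IsPath-segment : ∀ {r f} i d → i + d ≤ r → IsPath r f → IsPath d (λ z → f (i + z))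
  IsPath-segment {r} {f} i d i+d≤r f-path = record
    { injective = λ z z′ z≤ z′≤ eq → +-cancelˡ-≡ i _ _ (injective _ _ (bound z≤) (bound z′≤) eq)
    ; walk      = λ z z<d → subst (λ u → f (i + z) ~ f u) (sym (+-suc i z)) (walk (i + z) (subst (_≤ r) (+-suc i z) (bound z<d)))
    }
    where
    open IsPath f-path
    bound : ∀ {z} → z ≤ d → i + z ≤ r
    bound z≤d = ≤-trans (+-monoʳ-≤ i z≤d) i+d≤r

  IsPath-reverse : ∀ {r f} → IsPath r f → IsPath r (λ z → f (r ∸ z))
  IsPath-reverse {r} {f} f-path = record
    { injective = λ z z′ z≤ z′≤ eq → ∸-cancelˡ-≡ z≤ z′≤ (injective _ _ (m∸n≤m r z) (m∸n≤m r z′) eq)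
    ; walk      = λ z z<r → subst (λ u → f u ~ f (r ∸ suc z)) (sym (+-∸-assoc 1 z<r))
                              (~-sym (walk (r ∸ suc z) (∸-monoʳ-< z<s z<r)))
    }
    where open IsPath f-path

  ChordlessPath-point : ∀ v → ChordlessPath 0 (λ _ → v)
  ChordlessPath-point v = record { path = IsPath-point v ; chordless = λ { _ _ z≤n () } }

  ChordlessPath-segment : ∀ {r f} i d → i + d ≤ r → ChordlessPath r f → ChordlessPath d (λ z → f (i + z))
  ChordlessPath-segment {r} i d i+d≤r f-chordless = record
    { path      = IsPath-segment i d i+d≤r path
    ; chordless = λ z z′ z′≤d 2+z≤z′ → chordless (i + z) (i + z′) (≤-trans (+-monoʳ-≤ i z′≤d) i+d≤r)
                    (subst (_≤ i + z′) (trans (+-suc i (suc z)) (cong suc (+-suc i z))) (+-monoʳ-≤ i 2+z≤z′))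
    }
    where open ChordlessPath f-chordless

  ChordlessPath-reverse : ∀ {r f} → ChordlessPath r f → ChordlessPath r (λ z → f (r ∸ z))
  ChordlessPath-reverse {r} f-chordless = record
    { path      = IsPath-reverse path
    ; chordless = λ z z′ z′≤r 2+z≤z′ z~z′ →
        chordless (r ∸ z′) (r ∸ z) (m∸n≤m r z) (∸-gap z′≤r 2+z≤z′) (~-sym z~z′)
    }
    where
    open ChordlessPath f-chordless
    ∸-gap : ∀ {z z′} → z′ ≤ r → 2 + z ≤ z′ → 2 + (r ∸ z′) ≤ r ∸ z
    ∸-gap {z} z′≤r 2+z≤z′ with w , refl ← m≤n⇒∃[o]m+o≡n 2+z≤z′ | v , refl ← m≤n⇒∃[o]m+o≡n z′≤r =
      subst₂ (λ a b → 2 + a ≤ b) (sym (m+n∸m≡n (2 + z + w) v)) (sym (trans (cong (_∸ z) (reassoc z w v)) (m+n∸m≡n z _)))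
        (+-monoʳ-≤ 2 (m≤n+m v w))
      where
      reassoc : ∀ z w v → 2 + z + w + v ≡ z + (2 + (w + v))
      reassoc = solve-∀

  -- Cutting a closed path f 0 … f r along a chord f k ~ f (k + 2 + e) that is
  -- not the closing pair yields a shorter closed path whose apex is one of f.
  module Shortcut {r f} (cp : ClosedPath r f) (k e l : ℕ) (r≡ : r ≡ k + suc (suc e) + l)
                  (chord : f k ~ f (k + suc (suc e))) where
    open ClosedPath cp

    r′ : ℕ
    r′ = k + suc l

    g : ℕ → X
    g x = f (jump k (suc e) x)

    r′+e+1≡r : r′ + suc e ≡ r
    r′+e+1≡r = trans (reassoc k l e) (sym r≡)
      where
      reassoc : ∀ k l e → k + suc l + suc e ≡ k + suc (suc e) + l
      reassoc = solve-∀

    jump-0 : jump k (suc e) 0 ≡ 0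
    jump-0 = jump-≤ k (suc e) 0 z≤n

    jump-r′ : jump k (suc e) r′ ≡ r
    jump-r′ = trans (jump-> k (suc e) r′ (m<m+n k z<s)) r′+e+1≡r

    r′<r : r′ < r
    r′<r = subst (r′ <_) r′+e+1≡r (m<m+n r′ z<s)

    2≤r′ : k ≢ 0 ⊎ l ≢ 0 → 2 ≤ r′
    2≤r′ (inj₁ k≢0) = subst (2 ≤_) (sym (+-suc k l)) (s≤s (≤-trans (n≢0⇒n>0 k≢0) (m≤m+n k l)))
    2≤r′ (inj₂ l≢0) = ≤-trans (s≤s (n≢0⇒n>0 l≢0)) (m≤n+m (suc l) k)

    closed : ClosedPath r′ g
    closed = record { path = record { injective = g-injective ; walk = g-walk } ; closing = g-closing }
      where
      jump≤r : ∀ x → x ≤ r′ → jump k (suc e) x ≤ r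
      jump≤r x x≤r′ = subst (jump k (suc e) x ≤_) jump-r′ (jump-mono-≤ k (suc e) x≤r′)
      g-injective : InjectiveOn r′ g
      g-injective x y x≤ y≤ eq = jump-injective k (suc e) (injective _ _ (jump≤r x x≤) (jump≤r y y≤) eq)
      g-walk : Walk r′ g
      g-walk x x<r′ with <-cmp x k
      ... | tri< x<k _ _ =
        subst₂ (λ u v → f u ~ f v) (sym (jump-≤ k (suc e) x (<⇒≤ x<k))) (sym (jump-≤ k (suc e) (suc x) x<k))
          (walk x (<-trans x<k (<-trans (m<m+n k z<s) r′<r)))
      ... | tri≈ _ refl _ =
        subst₂ (λ u v → f u ~ f v) (sym (jump-≤ k (suc e) k ≤-refl))
          (sym (trans (jump-> k (suc e) (suc k) ≤-refl) (sym (+-suc k (suc e))))) chord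
      ... | tri> _ _ k<x =
        subst₂ (λ u v → f u ~ f v) (sym (jump-> k (suc e) x k<x)) (sym (jump-> k (suc e) (suc x) (m<n⇒m<1+n k<x)))
          (walk (x + suc e) (subst (suc x + suc e ≤_) r′+e+1≡r (+-monoˡ-≤ (suc e) x<r′)))
      g-closing : g 0 ~ g r′
      g-closing = subst₂ (λ u v → f u ~ f v) (sym jump-0) (sym jump-r′) closing

    apex-back : Apex r′ g → Apex r f
    apex-back (m , 0<m , m<r′ , f0~fm , fm~fr) =
      jump k (suc e) m , <-≤-trans 0<m (≤-jump k (suc e) m) ,
      subst (jump k (suc e) m <_) jump-r′ (jump-mono-< k (suc e) m<r′) ,
      subst (λ u → f u ~ g m) jump-0 f0~fm , subst (λ u → g m ~ f u) jump-r′ fm~fr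

  module _ (chordal : Chordal adj) where

    -- By induction on the length: a chord cuts off a shorter closed path (Shortcut).
    apex : ∀ r f → 2 ≤ r → ClosedPath r f → Apex r f
    apex = <-rec (λ r → ∀ f → 2 ≤ r → ClosedPath r f → Apex r f) step
      where
      step : ∀ r → (∀ {r′} → r′ < r → ∀ f → 2 ≤ r′ → ClosedPath r′ f → Apex r′ f) →
             ∀ f → 2 ≤ r → ClosedPath r f → Apex r f
      step (suc zero) _ f (s≤s ()) _
      step (suc (suc zero)) _ f _ cp = 1 , z<s , s<s z<s , walk 0 z<s , walk 1 (s<s z<s)
        where open ClosedPath cp
      step (suc (suc (suc m))) rec f _ cp = from-chord (chordal m cycle (cycle-injective , cycle-adjacent))
        where
        open ClosedPath cp
        cycle : Fin (4 + m) → X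
        cycle i = f (toℕ i)
        cycle-injective : ∀ {i j} → cycle i ≡ cycle j → i ≡ j
        cycle-injective {i} {j} eq = toℕ-injective (injective _ _ (≤-pred (toℕ<n i)) (≤-pred (toℕ<n j)) eq)
        cycle-adjacent : ∀ i → T (adj (cycle i) (cycle (next i)))
        cycle-adjacent i with toℕ-next i
        ... | inj₁ (i<r , eq) = subst (λ z → f (toℕ i) ~ f z) (sym eq) (walk _ i<r)
        ... | inj₂ (i≡r , eq) = subst₂ (λ z w → f z ~ f w) (sym i≡r) (sym eq) (~-sym closing)
        cut : ∀ k e l → suc (suc (suc m)) ≡ k + suc (suc e) + l → k ≢ 0 ⊎ l ≢ 0 →
              f k ~ f (k + suc (suc e)) → Apex (suc (suc (suc m))) f
        cut k e l r≡ not-closing chord = apex-back (rec r′<r g (2≤r′ not-closing) closed)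
          where open Shortcut cp k e l r≡ chord
        ordered-chord : ∀ i j → toℕ i < toℕ j → cycle i ~ cycle j → j ≢ next i → i ≢ next j →
                        Apex (suc (suc (suc m))) f
        ordered-chord i j i<j chord j≢i⁺ i≢j⁺
          with e , l , j≡ , r≡ , not-closing ← chord-positions i j i<j j≢i⁺ i≢j⁺ =
          cut (toℕ i) e l (trans r≡ (cong (_+ l) j≡)) not-closing (subst (λ z → cycle i ~ f z) j≡ chord)
        from-chord : HasChord adj m cycle → Apex (suc (suc (suc m))) f
        from-chord (i , j , i~j , i≢j , j≢i⁺ , i≢j⁺) with <-cmp (toℕ i) (toℕ j)
        ... | tri< i<j _ _ = ordered-chord i j i<j i~j j≢i⁺ i≢j⁺
        ... | tri≈ _ eq _  = ⊥-elim (i≢j (toℕ-injective eq))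
        ... | tri> _ _ j<i = ordered-chord j i j<i (~-sym i~j) i≢j⁺ j≢i⁺

    triangle-free⇒chordless : ∀ {r f} → IsPath r f →
      (∀ i j k → i < j → j < k → k ≤ r → f i ~ f j → f j ~ f k → ¬ f i ~ f k) → ChordlessPath r f
    triangle-free⇒chordless {r} {f} f-path no-triangle = record { path = f-path ; chordless = chordless }
      where
      chordless : ∀ i j → j ≤ r → 2 + i ≤ j → ¬ f i ~ f j
      chordless i j j≤r 2+i≤j fi~fj with d , refl ← m≤n⇒∃[o]m+o≡n (≤-trans (m≤n+m i 2) 2+i≤j)
        with m , 0<m , m<d , fi~fm , fm~fd ←
             apex d (λ z → f (i + z)) (+-cancelˡ-≤ i 2 d (subst (_≤ i + d) (+-comm 2 i) 2+i≤j))
               record { path = IsPath-segment i d j≤r f-path ; closing = subst (λ u → f u ~ f (i + d)) (sym (+-identityʳ i)) fi~fj } =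
            no-triangle i (i + m) (i + d) (m<m+n i 0<m) (+-monoʳ-< i m<d) j≤r
              (subst (λ u → f u ~ f (i + m)) (+-identityʳ i) fi~fm) fm~fd fi~fj

    module Ladder {α β x y} (x-path : ChordlessPath α x) (y-path : ChordlessPath β y)
                  (disjoint : ∀ i j → i ≤ α → j ≤ β → x i ≢ y j) (ends : x α ~ y β) where
      private
        module x = ChordlessPath x-path
        module y = ChordlessPath y-path

      module Rung {i j dα e} (i+dα≡α : i + dα ≡ α) (j+e≡β : j + e ≡ β) where
        xs ys f : ℕ → X
        xs z = x (i + z)
        ys z = y (j + (e ∸ z))
        f = append dα xs ys

        i+z≤α : ∀ {z} → z ≤ dα → i + z ≤ α
        i+z≤α z≤dα = subst (_ ≤_) i+dα≡α (+-monoʳ-≤ i z≤dα)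

        j+e∸z≤β : ∀ z → j + (e ∸ z) ≤ β
        j+e∸z≤β z = subst (_ ≤_) j+e≡β (+-monoʳ-≤ j (m∸n≤m e z))

        f-0 : f 0 ≡ x i
        f-0 = trans (append-≤ dα xs ys 0 z≤n) (cong x (+-identityʳ i))

        f-end : f (suc (dα + e)) ≡ y j
        f-end = trans (append-> dα xs ys e) (cong y (trans (cong (j +_) (n∸n≡0 e)) (+-identityʳ j)))

        closed : x i ~ y j → ClosedPath (suc (dα + e)) f
        closed xi~yj = ClosedPath-append
          (IsPath-segment i dα (≤-reflexive i+dα≡α) x.path)
          (IsPath-reverse (IsPath-segment j e (≤-reflexive j+e≡β) y.path))
          (λ z w z≤ _ → disjoint _ _ (i+z≤α z≤) (j+e∸z≤β w))
          (subst₂ (λ u v → x u ~ y v) (sym i+dα≡α) (sym j+e≡β) ends)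
          (subst₂ (λ u v → y u ~ x v) (sym (trans (cong (j +_) (n∸n≡0 e)) (+-identityʳ j))) (sym (+-identityʳ i)) (~-sym xi~yj))

        -- The apex of this closed path is x (i + 1) or y (j + 1), the paths being chordless.
        next-rung : 0 < dα + e → x i ~ y j → (0 < dα × x (suc i) ~ y j) ⊎ (0 < e × x i ~ y (suc j))
        next-rung 0<dα+e xi~yj
          with m , 0<m , m<r , f0~fm , fm~fr ← apex _ f (s≤s 0<dα+e) (closed xi~yj)
          with ≤⊎>-split dα m
        ... | inj₁ m≤dα = inj₁ (on-x m 0<m m≤dα (subst₂ _~_ f-0 (append-≤ dα xs ys m m≤dα) f0~fm)
                                                 (subst₂ _~_ (append-≤ dα xs ys m m≤dα) f-end fm~fr))
          where
          on-x : ∀ m → 0 < m → m ≤ dα → x i ~ x (i + m) → x (i + m) ~ y j → 0 < dα × x (suc i) ~ y j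
          on-x 1 _ 1≤dα _ x[i+1]~yj = 1≤dα , subst (λ u → x u ~ y j) (+-comm i 1) x[i+1]~yj
          on-x (suc (suc m)) _ m≤dα xi~x[i+m] _ =
            ⊥-elim (x.chordless i _ (i+z≤α m≤dα) (subst (_≤ i + suc (suc m)) (+-comm i 2) (+-monoʳ-≤ i (s≤s (s≤s z≤n)))) xi~x[i+m])
        ... | inj₂ (w , refl) = inj₂ (on-y (e ∸ w) refl (subst₂ _~_ f-0 (append-> dα xs ys w) f0~fm)
                                                         (subst₂ _~_ (append-> dα xs ys w) f-end fm~fr))
          where
          w<e : w < e
          w<e = +-cancelˡ-< dα _ _ (≤-pred m<r)
          on-y : ∀ u → e ∸ w ≡ u → x i ~ y (j + u) → y (j + u) ~ y j → 0 < e × x i ~ y (suc j)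
          on-y 0 e∸w≡0 _ _ = ⊥-elim (<-irrefl (sym e∸w≡0) (m<n⇒0<n∸m w<e))
          on-y 1 _ xi~y[j+1] _ = ≤-<-trans z≤n w<e , subst (λ u → x i ~ y u) (+-comm j 1) xi~y[j+1]
          on-y (suc (suc u)) e∸w≡u _ y[j+u]~yj =
            ⊥-elim (y.chordless j _ (subst (λ v → j + v ≤ β) e∸w≡u (j+e∸z≤β w))
                     (subst (_≤ j + suc (suc u)) (+-comm j 2) (+-monoʳ-≤ j (s≤s (s≤s z≤n)))) (~-sym y[j+u]~yj))

      -- Rungs advance one step at a time along x or along y, so an invariant
      -- that survives every possible advance holds at every rung reached.
      module Zip (Inv : ℕ → ℕ → Set)
                 (inv-x : ∀ i j → i < α → j ≤ β → Inv i j → x (suc i) ~ y j → Inv (suc i) j)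
                 (inv-y : ∀ i j → i ≤ α → j < β → Inv i j → x i ~ y (suc j) → Inv i (suc j)) where

        Zipped : ℕ → Set
        Zipped i = Inv α β × (∀ i′ → i ≤ i′ → i′ ≤ α → ∃[ j′ ] (j′ ≤ β × x i′ ~ y j′ × Inv i′ j′))

        private
          finished : ∀ {i j} → i ≡ α → j ≡ β → x i ~ y j → Inv i j → Zipped i
          finished refl refl xα~yβ inv = inv , last
            where
            last : ∀ i′ → α ≤ i′ → i′ ≤ α → ∃[ j′ ] (j′ ≤ β × x i′ ~ y j′ × Inv i′ j′)
            last i′ α≤i′ i′≤α with refl ← ≤-antisym i′≤α α≤i′ = β , ≤-refl , xα~yβ , inv

          extend : ∀ {i j} → j ≤ β → x i ~ y j → Inv i j → Zipped (suc i) → Zipped i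
          extend {i} {j} j≤β xi~yj inv (end , covers) = end , covers′
            where
            covers′ : ∀ i′ → i ≤ i′ → i′ ≤ α → ∃[ j′ ] (j′ ≤ β × x i′ ~ y j′ × Inv i′ j′)
            covers′ i′ i≤i′ i′≤α with m≤n⇒m<n∨m≡n i≤i′
            ... | inj₁ i<i′ = covers i′ i<i′ i′≤α
            ... | inj₂ refl = j , j≤β , xi~yj , inv

          -- recursion on n = dα + e, the number of advances still to come
          go : ∀ n dα e {i j} → dα + e ≡ n → i + dα ≡ α → j + e ≡ β → x i ~ y j → Inv i j → Zipped i
          go zero zero zero {i} {j} _ i+0≡α j+0≡β xi~yj inv =
            finished (trans (sym (+-identityʳ i)) i+0≡α) (trans (sym (+-identityʳ j)) j+0≡β) xi~yj inv
          go (suc n) dα e {i} {j} dα+e≡n i+dα≡α j+e≡β xi~yj inv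
            with Rung.next-rung i+dα≡α j+e≡β (subst (0 <_) (sym dα+e≡n) z<s) xi~yj
          ... | inj₁ (0<dα , x[i+1]~yj) with suc dα′ ← dα =
            extend j≤β xi~yj inv (go n dα′ e (suc-injective dα+e≡n) (trans (sym (+-suc i dα′)) i+dα≡α) j+e≡β x[i+1]~yj
              (inv-x i j (subst (i <_) i+dα≡α (m<m+n i z<s)) j≤β inv x[i+1]~yj))
            where
            j≤β : j ≤ β
            j≤β = subst (j ≤_) j+e≡β (m≤m+n j e)
          ... | inj₂ (0<e , xi~y[j+1]) with suc e′ ← e =
            go n dα e′ (suc-injective (trans (sym (+-suc dα e′)) dα+e≡n)) i+dα≡α (trans (sym (+-suc j e′)) j+e≡β) xi~y[j+1]
              (inv-y i j (subst (i ≤_) i+dα≡α (m≤m+n i dα)) (subst (j <_) j+e≡β (m<m+n j z<s)) inv xi~y[j+1])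

        zip-from : ∀ i j → i ≤ α → j ≤ β → x i ~ y j → Inv i j → Zipped i
        zip-from i j i≤α j≤β =
          let dα , i+dα≡α = m≤n⇒∃[o]m+o≡n i≤α
              e  , j+e≡β  = m≤n⇒∃[o]m+o≡n j≤β
          in go (dα + e) dα e refl i+dα≡α j+e≡β

    fan : ∀ {β y v} → ChordlessPath β y → (∀ j → j ≤ β → v ≢ y j) → v ~ y 0 → v ~ y β →
          ∀ j → j ≤ β → v ~ y j
    fan {β} {y} {v} y-path v∉y v~y0 v~yβ = proj₁ (zip-from 0 0 z≤n z≤n v~y0 inv-0)
      where
      v∉y′ : ∀ i j → i ≤ 0 → j ≤ β → v ≢ y j
      v∉y′ _ j _ j≤β = v∉y j j≤β
      open Ladder (ChordlessPath-point v) y-path v∉y′ v~yβ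
      Inv : ℕ → ℕ → Set
      Inv _ j = ∀ j′ → j′ ≤ j → v ~ y j′
      inv-0 : Inv 0 0
      inv-0 0 _ = v~y0
      inv-x : ∀ i j → i < 0 → j ≤ β → Inv i j → v ~ y j → Inv (suc i) j
      inv-x _ _ ()
      inv-y : ∀ i j → i ≤ 0 → j < β → Inv i j → v ~ y (suc j) → Inv i (suc j)
      inv-y _ j _ _ inv v~y[j+1] j′ j′≤ with m≤n⇒m<n∨m≡n j′≤
      ... | inj₁ j′< = inv j′ (≤-pred j′<)
      ... | inj₂ refl = v~y[j+1]
      open Zip Inv inv-x inv-y

    -- The closed path u, y 0, …, y β, v has an apex, which can only be y 0
    -- when y 0 is the only neighbour of u on y.
    module _ {β y u v} (y-path : ChordlessPath β y) (off-y : ∀ j → j ≤ β → u ≢ y j × v ≢ y j)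
             (v~u : v ~ u) (u~y0 : u ~ y 0) (yβ~v : y β ~ v) where
      private
        g f : ℕ → X
        g = append β y (λ _ → v)
        f = append 0 (λ _ → u) g

        g-values : ∀ w → w ≤ suc (β + 0) → (∃[ j ] (j ≤ β × g w ≡ y j)) ⊎ g w ≡ v
        g-values w w≤ with ≤⊎>-split β w
        ... | inj₁ w≤β = inj₁ (w , w≤β , append-≤ β y (λ _ → v) w w≤β)
        ... | inj₂ (0 , refl) = inj₂ (append-> β y (λ _ → v) 0)
        ... | inj₂ (suc k , refl) with () ← +-cancelˡ-≤ β (suc k) 0 (≤-pred w≤)

        closed : u ≢ v → ClosedPath (suc (suc (β + 0))) f
        closed u≢v = ClosedPath-append (IsPath-point u)
          (IsPath-append (ChordlessPath.path y-path) (IsPath-point v) (λ j _ j≤β _ → proj₂ (off-y j j≤β) ∘′ sym) yβ~v)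
          (λ { 0 w _ w≤ eq → case g-values w w≤ of λ where
                 (inj₁ (j , j≤β , gw≡yj)) → proj₁ (off-y j j≤β) (trans eq gw≡yj)
                 (inj₂ gw≡v) → u≢v (trans eq gw≡v) })
          (subst (u ~_) (sym (append-≤ β y (λ _ → v) 0 z≤n)) u~y0) (subst (_~ u) (sym (append-> β y (λ _ → v) 0)) v~u)

      corner : u ≢ v → (∀ j → j ≤ β → u ~ y j → j ≡ 0) → v ~ y 0
      corner u≢v u-sees-only-y0
        with suc m′ , _ , m<r , u~fm , fm~v ← apex _ f (s≤s (s≤s z≤n)) (closed u≢v)
        with m′≤β ← subst (m′ ≤_) (+-identityʳ β) (≤-pred (≤-pred m<r))
        with refl ← u-sees-only-y0 m′ m′≤β (subst (u ~_) (append-≤ β y (λ _ → v) m′ m′≤β) u~fm) =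
        ~-sym (subst₂ _~_ (append-≤ β y (λ _ → v) 0 z≤n) (append-> β y (λ _ → v) 0) fm~v)

  argmin : ∀ {k} (g : Fin (suc k) → ℕ) → ∃[ i ] (∀ j → g i ≤ g j)
  argmin {zero}  g = fzero , λ { fzero → ≤-refl }
  argmin {suc k} g with i , min ← argmin (g ∘′ fsuc) | g fzero ≤? g (fsuc i)
  ... | yes g0≤ = fzero , λ { fzero → ≤-refl ; (fsuc j) → ≤-trans g0≤ (min j) }
  ... | no g0≰  = fsuc i , λ { fzero → <⇒≤ (≰⇒> g0≰) ; (fsuc j) → min j }

  module EliminationOrdering (rank : X → ℕ) (rank-injective : ∀ u v → rank u ≡ rank v → u ≡ v)
    (later-neighbours-adjacent : ∀ v u w → v ~ u → v ~ w → rank v < rank u → rank v < rank w → u ≢ w → u ~ w) where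

    -- The two cycle neighbours of the vertex of least rank are joined by a chord.
    elimination⇒chordal : Chordal adj
    elimination⇒chordal m cycle (cycle-injective , cycle-adjacent) =
      before , after , later-neighbours-adjacent _ _ _ first~before first~after
                         (later before≢first) (later after≢first) (before≢after ∘′ cycle-injective) ,
      before≢after , after≢next-before , before≢next-after
      where
      first : Fin (4 + m)
      first = proj₁ (argmin (rank ∘′ cycle))
      before : Fin (4 + m)
      before = proj₁ (next-surjective first)
      after : Fin (4 + m)
      after = next first
      next-before≡first : next before ≡ first
      next-before≡first = proj₂ (next-surjective first)
      steps : Follows (3 + m) (toℕ before) (toℕ first) × Follows (3 + m) (toℕ first) (toℕ after)
            × Follows (3 + m) (toℕ after) (toℕ (next after))
      steps = subst (Follows _ _) (cong toℕ next-before≡first) (toℕ-next before) , toℕ-next first , toℕ-next after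
      ≢-from-toℕ : ∀ {i j : Fin (4 + m)} → toℕ i ≢ toℕ j → i ≢ j
      ≢-from-toℕ ne refl = ne refl
      before≢first : before ≢ first
      before≢first = ≢-from-toℕ (follows-≢ (proj₁ steps) z<s)
      after≢first : after ≢ first
      after≢first = ≢-from-toℕ (follows-≢ (proj₁ (proj₂ steps)) z<s ∘′ sym)
      before≢after : before ≢ after
      before≢after = ≢-from-toℕ (follows²-≢ (proj₁ steps) (proj₁ (proj₂ steps)) (s≤s (s≤s z≤n)))
      after≢next-before : after ≢ next before
      after≢next-before eq = after≢first (trans eq next-before≡first)
      before≢next-after : before ≢ next after
      before≢next-after = ≢-from-toℕ (follows³-≢ (proj₁ steps) (proj₁ (proj₂ steps)) (proj₂ (proj₂ steps)) (s≤s (s≤s (s≤s z≤n))))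
      first~before : cycle first ~ cycle before
      first~before = ~-sym (subst (λ i → cycle before ~ cycle i) next-before≡first (cycle-adjacent before))
      first~after : cycle first ~ cycle after
      first~after = cycle-adjacent first
      later : ∀ {i} → i ≢ first → rank (cycle first) < rank (cycle i)
      later {i} i≢first = ≤∧≢⇒< (proj₂ (argmin (rank ∘′ cycle)) i) (λ eq → i≢first (sym (cycle-injective (rank-injective _ _ eq))))

-- Arithmetic modulo 2 and 4

%2-cases : ∀ x → x % 2 ≡ 0 ⊎ x % 2 ≡ 1
%2-cases x with x % 2 | m%n<n x 2
... | 0 | _ = inj₁ refl
... | 1 | _ = inj₂ refl
... | suc (suc _) | s≤s (s≤s ())

[2+x]%2≡x%2 : ∀ x → (2 + x) % 2 ≡ x % 2
[2+x]%2≡x%2 x = trans (cong (_% 2) (+-comm 2 x)) ([m+n]%n≡m%n x 2)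

[1+x]%2≢x%2 : ∀ x → suc x % 2 ≢ x % 2
[1+x]%2≢x%2 zero ()
[1+x]%2≢x%2 (suc zero) ()
[1+x]%2≢x%2 (suc (suc x)) eq = [1+x]%2≢x%2 x (trans (sym ([2+x]%2≡x%2 (suc x))) (trans eq ([2+x]%2≡x%2 x)))

[4u+x]%2≡x%2 : ∀ u x → (4 * u + x) % 2 ≡ x % 2
[4u+x]%2≡x%2 u x = trans (cong (_% 2) (reorder u x)) ([m+kn]%n≡m%n x (2 * u) 2)
  where
  reorder : ∀ u x → 4 * u + x ≡ x + 2 * u * 2
  reorder = solve-∀

[x+4u]%4≡x%4 : ∀ x u → (x + 4 * u) % 4 ≡ x % 4
[x+4u]%4≡x%4 x u = trans (cong (λ v → (x + v) % 4) (*-comm 4 u)) ([m+kn]%n≡m%n x u 4)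

[4u+x]%4≡x%4 : ∀ u x → (4 * u + x) % 4 ≡ x % 4
[4u+x]%4≡x%4 u x = trans (cong (_% 4) (+-comm (4 * u) x)) ([x+4u]%4≡x%4 x u)

%4-cases : ∀ x → x % 4 ≡ 0 ⊎ x % 4 ≡ 1 ⊎ x % 4 ≡ 2 ⊎ x % 4 ≡ 3
%4-cases x with x % 4 | m%n<n x 4
... | 0 | _ = inj₁ refl
... | 1 | _ = inj₂ (inj₁ refl)
... | 2 | _ = inj₂ (inj₂ (inj₁ refl))
... | 3 | _ = inj₂ (inj₂ (inj₂ refl))
... | suc (suc (suc (suc _))) | s≤s (s≤s (s≤s (s≤s ())))

%4%2≡%2 : ∀ x → x % 4 % 2 ≡ x % 2
%4%2≡%2 x = m∣n⇒o%n%m≡o%m 2 4 x (divides 2 refl)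

three-parities : ∀ x y z → x % 2 ≢ y % 2 → y % 2 ≢ z % 2 → x % 2 ≢ z % 2 → ⊥
three-parities x y z xy yz xz with %2-cases x | %2-cases y | %2-cases z
... | inj₁ ex | inj₁ ey | _       = xy (trans ex (sym ey))
... | inj₂ ex | inj₂ ey | _       = xy (trans ex (sym ey))
... | inj₁ ex | inj₂ _  | inj₁ ez = xz (trans ex (sym ez))
... | inj₂ _  | inj₁ ey | inj₁ ez = yz (trans ey (sym ez))
... | inj₁ _  | inj₂ ey | inj₂ ez = yz (trans ey (sym ez))
... | inj₂ ex | inj₁ _  | inj₂ ez = xz (trans ex (sym ez))

same-parity-close⇒≡ : ∀ {j k} → j % 2 ≡ k % 2 → j ≤ suc k → k ≤ suc j → j ≡ k
same-parity-close⇒≡ {j} {k} same j≤k+1 k≤j+1 with m≤n⇒m<n∨m≡n j≤k+1 | m≤n⇒m<n∨m≡n k≤j+1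
... | inj₁ j≤k | inj₁ k≤j = ≤-antisym (≤-pred j≤k) (≤-pred k≤j)
... | inj₂ refl | _ = ⊥-elim ([1+x]%2≢x%2 k same)
... | _ | inj₂ refl = ⊥-elim ([1+x]%2≢x%2 j (sym same))

[1+x]%2≡1∸x%2 : ∀ x → suc x % 2 ≡ 1 ∸ x % 2
[1+x]%2≡1∸x%2 x with %2-cases x | %2-cases (suc x)
... | inj₁ e | inj₁ e′ = ⊥-elim ([1+x]%2≢x%2 x (trans e′ (sym e)))
... | inj₁ e | inj₂ o′ = trans o′ (cong (1 ∸_) (sym e))
... | inj₂ o | inj₁ e′ = trans e′ (cong (1 ∸_) (sym o))
... | inj₂ o | inj₂ o′ = ⊥-elim ([1+x]%2≢x%2 x (trans o′ (sym o)))

[x+e]%4≢x%4 : ∀ x e → 1 ≤ e → e ≤ 3 → (x + e) % 4 ≢ x % 4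
[x+e]%4≢x%4 x e 1≤e e≤3 eq = differ (%4-cases x) e 1≤e e≤3 (trans (sym (%-distribˡ-+ x e 4)) eq)
  where
  differ : ∀ {r} → r ≡ 0 ⊎ r ≡ 1 ⊎ r ≡ 2 ⊎ r ≡ 3 → ∀ e → 1 ≤ e → e ≤ 3 → (r + e % 4) % 4 ≢ r
  differ (inj₁ refl)                   1 _ _ ()
  differ (inj₁ refl)                   2 _ _ ()
  differ (inj₁ refl)                   3 _ _ ()
  differ (inj₂ (inj₁ refl))            1 _ _ ()
  differ (inj₂ (inj₁ refl))            2 _ _ ()
  differ (inj₂ (inj₁ refl))            3 _ _ ()
  differ (inj₂ (inj₂ (inj₁ refl)))     1 _ _ ()
  differ (inj₂ (inj₂ (inj₁ refl)))     2 _ _ ()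
  differ (inj₂ (inj₂ (inj₁ refl)))     3 _ _ ()
  differ (inj₂ (inj₂ (inj₂ refl)))     1 _ _ ()
  differ (inj₂ (inj₂ (inj₂ refl)))     2 _ _ ()
  differ (inj₂ (inj₂ (inj₂ refl)))     3 _ _ ()
  differ _ (suc (suc (suc (suc _)))) _ (s≤s (s≤s (s≤s ())))

mod-4-gap : ∀ {x y} → x < y → x % 4 ≡ y % 4 → y ≤ x + 3 → ⊥
mod-4-gap {x} x<y eq y≤ with e , refl ← m≤n⇒∃[o]m+o≡n x<y =
  [x+e]%4≢x%4 x (suc e) (s≤s z≤n) (+-cancelˡ-≤ x (suc e) 3 (subst (_≤ x + 3) (sym (+-suc x e)) y≤))
    (trans (cong (_% 4) (+-suc x e)) (sym eq))

close-mod-4⇒≡ : ∀ {x y} → x % 4 ≡ y % 4 → x ≤ y + 3 → y ≤ x + 3 → x ≡ y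
close-mod-4⇒≡ {x} {y} eq x≤ y≤ with <-cmp x y
... | tri≈ _ x≡y _ = x≡y
... | tri< x<y _ _ = ⊥-elim (mod-4-gap x<y eq y≤)
... | tri> _ _ y<x = ⊥-elim (mod-4-gap y<x (sym eq) x≤)

even-not-2-mod-4 : ∀ x → x % 2 ≡ 0 → (x + 2) % 4 ≢ 0 → ∃[ Δ ] (x ≡ 4 * Δ)
even-not-2-mod-4 x even x+2≢0 = x / 4 , trans (m≡m%n+[m/n]*n x 4) (trans (cong (_+ x / 4 * 4) x%4≡0) (*-comm (x / 4) 4))
  where
  x%4≡0 : x % 4 ≡ 0
  x%4≡0 with %4-cases x
  ... | inj₁ r = r
  ... | inj₂ (inj₁ r) = ⊥-elim (0≢1+n (trans (sym even) (trans (sym (%4%2≡%2 x)) (cong (_% 2) r))))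
  ... | inj₂ (inj₂ (inj₁ r)) = ⊥-elim (x+2≢0 (trans (%-distribˡ-+ x 2 4) (cong (λ u → (u + 2) % 4) r)))
  ... | inj₂ (inj₂ (inj₂ r)) = ⊥-elim (0≢1+n (trans (sym even) (trans (sym (%4%2≡%2 x)) (cong (_% 2) r))))

odd-not-opposite-mod-4 : ∀ l k → l % 2 ≡ 1 → k % 2 ≡ 1 → (l + 2) % 4 ≢ k % 4 → l % 4 ≡ k % 4
odd-not-opposite-mod-4 l k l-odd k-odd apart =
  agree (%4-cases l) (%4-cases k) (trans (%4%2≡%2 l) l-odd) (trans (%4%2≡%2 k) k-odd) (apart ∘′ trans (%-distribˡ-+ l 2 4))
  where
  agree : ∀ {x y} → x ≡ 0 ⊎ x ≡ 1 ⊎ x ≡ 2 ⊎ x ≡ 3 → y ≡ 0 ⊎ y ≡ 1 ⊎ y ≡ 2 ⊎ y ≡ 3 →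
          x % 2 ≡ 1 → y % 2 ≡ 1 → (x + 2) % 4 ≢ y → x ≡ y
  agree (inj₂ (inj₁ refl))        (inj₂ (inj₁ refl))        _ _ _ = refl
  agree (inj₂ (inj₂ (inj₂ refl))) (inj₂ (inj₂ (inj₂ refl))) _ _ _ = refl
  agree (inj₂ (inj₁ refl))        (inj₂ (inj₂ (inj₂ refl))) _ _ apart′ = ⊥-elim (apart′ refl)
  agree (inj₂ (inj₂ (inj₂ refl))) (inj₂ (inj₁ refl))        _ _ apart′ = ⊥-elim (apart′ refl)
  agree (inj₁ refl)               _ () _ _
  agree (inj₂ (inj₂ (inj₁ refl))) _ () _ _
  agree (inj₂ (inj₁ refl))        (inj₁ refl)               _ () _
  agree (inj₂ (inj₁ refl))        (inj₂ (inj₂ (inj₁ refl))) _ () _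
  agree (inj₂ (inj₂ (inj₂ refl))) (inj₁ refl)               _ () _
  agree (inj₂ (inj₂ (inj₂ refl))) (inj₂ (inj₂ (inj₁ refl))) _ () _

[4Δ+k]/4≡Δ+k/4 : ∀ Δ k → (4 * Δ + k) / 4 ≡ Δ + k / 4
[4Δ+k]/4≡Δ+k/4 Δ k = trans (+-distrib-/-∣ˡ k {4} (divides Δ (*-comm 4 Δ)))
                            (cong (_+ k / 4) (trans (cong (_/ 4) (*-comm 4 Δ)) (m*n/n≡m Δ 4)))

%2≤1 : ∀ x → x % 2 ≤ 1
%2≤1 x = ≤-pred (m%n<n x 2)

1∸x≤1 : ∀ x → 1 ∸ x ≤ 1
1∸x≤1 x = m∸n≤m 1 x

1+[2x+1]≡2[1+x] : ∀ x → suc (2 * x + 1) ≡ 2 * suc x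
1+[2x+1]≡2[1+x] = solve-∀

2x+u<2[1+x] : ∀ x {u} → u ≤ 1 → 2 * x + u < 2 * suc x
2x+u<2[1+x] x u≤1 = ≤-trans (s≤s (+-monoʳ-≤ (2 * x) u≤1)) (≤-reflexive (1+[2x+1]≡2[1+x] x))

2x+u-injective : ∀ {x y u v} → u ≤ 1 → v ≤ 1 → 2 * x + u ≡ 2 * y + v → x ≡ y × u ≡ v
2x+u-injective {x} {y} {u} {v} u≤1 v≤1 eq with <-cmp x y
... | tri≈ _ refl _ = refl , +-cancelˡ-≡ (2 * x) u v eq
... | tri< x<y _ _ = ⊥-elim (<-irrefl eq (<-≤-trans (2x+u<2[1+x] x u≤1) (≤-trans (*-monoʳ-≤ 2 x<y) (m≤m+n (2 * y) v))))
... | tri> _ _ y<x = ⊥-elim (<-irrefl (sym eq) (<-≤-trans (2x+u<2[1+x] y v≤1) (≤-trans (*-monoʳ-≤ 2 y<x) (m≤m+n (2 * x) u))))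

-- Positions of p_{k+1} and q_{D+m+1} in the elimination ordering of the construction,
-- counted after the head: p₁ q_{D+1} q_{D+2} p₂ p₃ q_{D+3} q_{D+4} p₄ …
p-rank q-rank : ℕ → ℕ
p-rank k = 2 * k + k % 2
q-rank m = 2 * m + (1 ∸ m % 2)

p-rank-injective : ∀ {k k′} → p-rank k ≡ p-rank k′ → k ≡ k′
p-rank-injective {k} {k′} = proj₁ ∘′ 2x+u-injective (%2≤1 k) (%2≤1 k′)

q-rank-injective : ∀ {m m′} → q-rank m ≡ q-rank m′ → m ≡ m′
q-rank-injective {m} {m′} = proj₁ ∘′ 2x+u-injective (1∸x≤1 (m % 2)) (1∸x≤1 (m′ % 2))

p-rank≢q-rank : ∀ k m → p-rank k ≢ q-rank m
p-rank≢q-rank k m eq with 2x+u-injective {k} {m} (%2≤1 k) (1∸x≤1 (m % 2)) eq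
... | refl , k%2≡1∸k%2 with %2-cases k
...   | inj₁ even = 0≢1+n (trans (sym even) (trans k%2≡1∸k%2 (cong (1 ∸_) even)))
...   | inj₂ odd  = 0≢1+n (sym (trans (sym odd) (trans k%2≡1∸k%2 (cong (1 ∸_) odd))))

p-rank<2[1+k] : ∀ k → p-rank k < 2 * suc k
p-rank<2[1+k] k = 2x+u<2[1+x] k (%2≤1 k)

q-rank<2[1+m] : ∀ m → q-rank m < 2 * suc m
q-rank<2[1+m] m = 2x+u<2[1+x] m (1∸x≤1 (m % 2))

p-rank-suc : ∀ k → p-rank k < p-rank (suc k)
p-rank-suc k = ≤-trans (p-rank<2[1+k] k) (m≤m+n _ _)

q-rank-suc : ∀ m → q-rank m < q-rank (suc m)
q-rank-suc m = ≤-trans (q-rank<2[1+m] m) (m≤m+n _ _)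

-- The vertex of Q above p_{k+1} has index k rounded up to an even number, and
-- the vertex of P above q_{D+m+1} has index m rounded up to an odd number.
even-ceil odd-ceil : ℕ → ℕ
even-ceil k = k + k % 2
odd-ceil m = m + (1 ∸ m % 2)

p-rank<q-rank-even-ceil : ∀ k → p-rank k < q-rank (even-ceil k)
p-rank<q-rank-even-ceil k with %2-cases k
... | inj₁ even = subst₂ _<_ (cong (2 * k +_) (sym even)) (sym q-rank≡) (+-monoʳ-< (2 * k) z<s)
  where
  q-rank≡ : q-rank (even-ceil k) ≡ 2 * k + 1
  q-rank≡ = trans (cong q-rank (trans (cong (k +_) even) (+-identityʳ k))) (cong (λ r → 2 * k + (1 ∸ r)) even)
... | inj₂ odd =
  ≤-trans (p-rank<2[1+k] k) (≤-trans (≤-reflexive (cong (2 *_) (trans (+-comm 1 k) (cong (k +_) (sym odd))))) (m≤m+n _ _))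

q-rank<p-rank-odd-ceil : ∀ m → q-rank m < p-rank (odd-ceil m)
q-rank<p-rank-odd-ceil m with %2-cases m
... | inj₁ even =
  ≤-trans (q-rank<2[1+m] m) (≤-trans (≤-reflexive (cong (2 *_) (trans (+-comm 1 m) (cong (λ r → m + (1 ∸ r)) (sym even))))) (m≤m+n _ _))
... | inj₂ odd = subst₂ _<_ (cong (λ r → 2 * m + (1 ∸ r)) (sym odd)) (sym p-rank≡) (+-monoʳ-< (2 * m) z<s)
  where
  p-rank≡ : p-rank (odd-ceil m) ≡ 2 * m + 1
  p-rank≡ = trans (cong p-rank (trans (cong (λ r → m + (1 ∸ r)) odd) (+-identityʳ m))) (cong (2 * m +_) odd)

even-ceil-even : ∀ {k} → k % 2 ≡ 0 → even-ceil k ≡ k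
even-ceil-even {k} even = trans (cong (k +_) even) (+-identityʳ k)

even-ceil-odd : ∀ {k} → k % 2 ≡ 1 → even-ceil k ≡ suc k
even-ceil-odd {k} odd = trans (cong (k +_) odd) (+-comm k 1)

odd-ceil-even : ∀ {m} → m % 2 ≡ 0 → odd-ceil m ≡ suc m
odd-ceil-even {m} even = trans (cong (λ r → m + (1 ∸ r)) even) (+-comm m 1)

odd-ceil-odd : ∀ {m} → m % 2 ≡ 1 → odd-ceil m ≡ m
odd-ceil-odd {m} odd = trans (cong (λ r → m + (1 ∸ r)) odd) (+-identityʳ m)

odd⇒suc-even : ∀ {k} → k % 2 ≡ 1 → suc k % 2 ≡ 0
odd⇒suc-even {k} odd = trans ([1+x]%2≡1∸x%2 k) (cong (1 ∸_) odd)

even⇒suc-odd : ∀ {k} → k % 2 ≡ 0 → suc k % 2 ≡ 1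
even⇒suc-odd {k} even = trans ([1+x]%2≡1∸x%2 k) (cong (1 ∸_) even)

mod-4-apart : ∀ x e → 1 ≤ e → e ≤ 3 → x % 4 ≢ (x + e) % 4
mod-4-apart x e 1≤e e≤3 = [x+e]%4≢x%4 x e 1≤e e≤3 ∘′ sym

even-ceil-is-even : ∀ k → even-ceil k % 2 ≡ 0
even-ceil-is-even k with %2-cases k
... | inj₁ even = trans (cong (_% 2) (even-ceil-even {k} even)) even
... | inj₂ odd  = trans (cong (_% 2) (even-ceil-odd {k} odd)) (odd⇒suc-even {k} odd)

odd-ceil-is-odd : ∀ m → odd-ceil m % 2 ≡ 1
odd-ceil-is-odd m with %2-cases m
... | inj₁ even = trans (cong (_% 2) (odd-ceil-even {m} even)) (even⇒suc-odd {m} even)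
... | inj₂ odd  = trans (cong (_% 2) (odd-ceil-odd {m} odd)) odd

-- The zipper gadget

module Gadget (n s : ℕ) (1≤n : 1 ≤ n) where

  NP NQ : ℕ
  NP = 4 * n ∸ 1
  NQ = 4 * (n + s)

  NP+1≡4n : NP + 1 ≡ 4 * n
  NP+1≡4n = m∸n+n≡m {4 * n} {1} (≤-trans (s≤s z≤n) (*-monoʳ-≤ 4 1≤n))

  3≤NP : 3 ≤ NP
  3≤NP = +-cancelʳ-≤ 1 3 NP (subst (4 ≤_) (sym NP+1≡4n) (*-monoʳ-≤ 4 1≤n))

  0<NP : 0 < NP
  0<NP = ≤-trans (s≤s z≤n) 3≤NP

  NP<NQ : NP < NQ
  NP<NQ = subst (_≤ NQ) (trans (sym NP+1≡4n) (+-comm NP 1)) (*-monoʳ-≤ 4 (m≤m+n n s))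

  NQ′ : ℕ
  NQ′ = NQ ∸ 1

  1+NQ′≡NQ : suc NQ′ ≡ NQ
  1+NQ′≡NQ = trans (+-comm 1 NQ′) (m∸n+n≡m {NQ} {1} (≤-trans (s≤s z≤n) NP<NQ))

  NQ′<NQ : NQ′ < NQ
  NQ′<NQ = subst (NQ′ <_) 1+NQ′≡NQ ≤-refl

  NP-odd : NP % 2 ≡ 1
  NP-odd with %2-cases NP
  ... | inj₂ odd = odd
  ... | inj₁ even = ⊥-elim ([1+x]%2≢x%2 NP (trans (cong (_% 2) (trans (+-comm 1 NP) NP+1≡4n))
                                                 (trans (cong (_% 2) (sym (+-identityʳ (4 * n)))) (trans ([4u+x]%2≡x%2 n 0) (sym even)))))

  -- pv k and qv l are the vertices p_{k+1} and q_{l+1}; out-of-range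
  -- indices give the tail t, so that P ends in pv NP ≡ t.
  pv qv : ℕ → V n s
  pv k with k <? NP
  ... | yes k<NP = p (fromℕ< k<NP)
  ... | no _     = t
  qv l with l <? NQ
  ... | yes l<NQ = q (fromℕ< l<NQ)
  ... | no _     = t

  pv-< : ∀ {k} (k<NP : k < NP) → pv k ≡ p (fromℕ< k<NP)
  pv-< {k} k<NP with k <? NP
  ... | yes _ = cong p (fromℕ<-cong k k refl _ _)
  ... | no k≮NP = ⊥-elim (k≮NP k<NP)

  pv-≥ : ∀ {k} → NP ≤ k → pv k ≡ t
  pv-≥ {k} NP≤k with k <? NP
  ... | yes k<NP = ⊥-elim (<-irrefl refl (<-≤-trans k<NP NP≤k))
  ... | no _ = refl

  qv-< : ∀ {l} (l<NQ : l < NQ) → qv l ≡ q (fromℕ< l<NQ)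
  qv-< {l} l<NQ with l <? NQ
  ... | yes _ = cong q (fromℕ<-cong l l refl _ _)
  ... | no l≮NQ = ⊥-elim (l≮NQ l<NQ)

  qv-≥ : ∀ {l} → NQ ≤ l → qv l ≡ t
  qv-≥ {l} NQ≤l with l <? NQ
  ... | yes l<NQ = ⊥-elim (<-irrefl refl (<-≤-trans l<NQ NQ≤l))
  ... | no _ = refl

  pv-toℕ : ∀ (i : Fin NP) → pv (toℕ i) ≡ p i
  pv-toℕ i = trans (pv-< (toℕ<n i)) (cong p (toℕ-injective (toℕ-fromℕ< (toℕ<n i))))

  qv-toℕ : ∀ (j : Fin NQ) → qv (toℕ j) ≡ q j
  qv-toℕ j = trans (qv-< (toℕ<n j)) (cong q (toℕ-injective (toℕ-fromℕ< (toℕ<n j))))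

  odd⇒suc<NP : ∀ {k} → k < NP → k % 2 ≡ 1 → suc k < NP
  odd⇒suc<NP {k} k< odd with m≤n⇒m<n∨m≡n k<
  ... | inj₁ k+1< = k+1<
  ... | inj₂ k+1≡NP = ⊥-elim ([1+x]%2≢x%2 k (trans (cong (_% 2) k+1≡NP) (trans NP-odd (sym odd))))

  pv-cases : ∀ k → (Σ (k < NP) λ k<NP → pv k ≡ p (fromℕ< k<NP)) ⊎ (NP ≤ k × pv k ≡ t)
  pv-cases k = case k <? NP of λ where
    (yes k<NP) → inj₁ (k<NP , pv-< k<NP)
    (no k≮NP)  → inj₂ (≮⇒≥ k≮NP , pv-≥ (≮⇒≥ k≮NP))

  qv-cases : ∀ l → (Σ (l < NQ) λ l<NQ → qv l ≡ q (fromℕ< l<NQ)) ⊎ (NQ ≤ l × qv l ≡ t)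
  qv-cases l = case l <? NQ of λ where
    (yes l<NQ) → inj₁ (l<NQ , qv-< l<NQ)
    (no l≮NQ)  → inj₂ (≮⇒≥ l≮NQ , qv-≥ (≮⇒≥ l≮NQ))

  pv-injective : ∀ {k k′} → k ≤ NP → k′ ≤ NP → pv k ≡ pv k′ → k ≡ k′
  pv-injective {k} {k′} k≤NP k′≤NP eq with pv-cases k | pv-cases k′
  ... | inj₁ (k< , e) | inj₁ (k′< , e′) =
    trans (sym (toℕ-fromℕ< k<)) (trans (cong toℕ (p-injective (trans (sym e) (trans eq e′)))) (toℕ-fromℕ< k′<))
    where
    p-injective : ∀ {i i′ : Fin NP} → p {n} {s} i ≡ p i′ → i ≡ i′
    p-injective refl = refl
  ... | inj₁ (_ , e) | inj₂ (_ , e′) with () ← trans (sym e) (trans eq e′)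
  ... | inj₂ (_ , e) | inj₁ (_ , e′) with () ← trans (sym e′) (trans (sym eq) e)
  ... | inj₂ (NP≤k , _) | inj₂ (NP≤k′ , _) = trans (≤-antisym k≤NP NP≤k) (sym (≤-antisym k′≤NP NP≤k′))

  qv-injective : ∀ {l l′} → l < NQ → l′ < NQ → qv l ≡ qv l′ → l ≡ l′
  qv-injective {l} {l′} l< l′< eq =
    trans (sym (toℕ-fromℕ< l<)) (trans (cong toℕ (q-injective (trans (sym (qv-< l<)) (trans eq (qv-< l′<))))) (toℕ-fromℕ< l′<))
    where
    q-injective : ∀ {j j′ : Fin NQ} → q {n} {s} j ≡ q j′ → j ≡ j′
    q-injective refl = refl

  pv≢qv : ∀ {k l} → l < NQ → pv k ≢ qv l
  pv≢qv {k} l<NQ eq with pv-cases k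
  ... | inj₁ (_ , e) with () ← trans (sym e) (trans eq (qv-< l<NQ))
  ... | inj₂ (_ , e) with () ← trans (sym e) (trans eq (qv-< l<NQ))

  pv≢h : ∀ k → pv k ≢ h
  pv≢h k eq with pv-cases k
  ... | inj₁ (_ , e) with () ← trans (sym e) eq
  ... | inj₂ (_ , e) with () ← trans (sym e) eq

  qv≢h : ∀ {l} → l < NQ → qv l ≢ h
  qv≢h l<NQ eq with () ← trans (sym (qv-< l<NQ)) eq

  data PColour (k : ℕ) (col : Color) : Set where
    p-a : col ≡ a  → k % 2 ≡ 0 → PColour k col
    p-b : col ≡ bP → k % 2 ≡ 1 → PColour k col
    p-c : col ≡ c (k mod 4) → PColour k col

  data QColour (l : ℕ) (col : Color) : Set where
    q-b : col ≡ bQ → l % 2 ≡ 0 → QColour l col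
    q-a : col ≡ a  → l % 2 ≡ 1 → QColour l col
    q-c : col ≡ c ((l + 2) mod 4) → QColour l col

  pv-colour : ∀ {k col} → k < NP → PColour k col → HasColor (pv k) col
  pv-colour {k} k<NP col rewrite pv-< k<NP | toℕ-fromℕ< k<NP with col
  ... | p-a refl even rewrite even = here refl
  ... | p-b refl odd  rewrite odd  = here refl
  ... | p-c refl = there (here refl)

  qv-colour : ∀ {l col} → l < NQ → QColour l col → HasColor (qv l) col
  qv-colour {l} l<NQ col rewrite qv-< l<NQ | toℕ-fromℕ< l<NQ with col
  ... | q-b refl even rewrite even = here refl
  ... | q-a refl odd  rewrite odd  = here refl
  ... | q-c refl = there (here refl)

  p-colours : ∀ {i col} → HasColor {n} {s} (p i) col → PColour (toℕ i) col
  p-colours {i} {col} (here eq) with %2-cases (toℕ i)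
  ... | inj₁ even = p-a (subst (λ r → col ≡ (if r ≡ᵇ 0 then a else bP)) even eq) even
  ... | inj₂ odd  = p-b (subst (λ r → col ≡ (if r ≡ᵇ 0 then a else bP)) odd eq) odd
  p-colours (there (here eq)) = p-c eq

  q-colours : ∀ {j col} → HasColor {n} {s} (q j) col → QColour (toℕ j) col
  q-colours {j} {col} (here eq) with %2-cases (toℕ j)
  ... | inj₁ even = q-b (subst (λ r → col ≡ (if r ≡ᵇ 0 then bQ else a)) even eq) even
  ... | inj₂ odd  = q-a (subst (λ r → col ≡ (if r ≡ᵇ 0 then bQ else a)) odd eq) odd
  q-colours (there (here eq)) = q-c eq

  a∈p⇒even : ∀ {i} → HasColor {n} {s} (p i) a → toℕ i % 2 ≡ 0
  a∈p⇒even {i} has-a with p-colours {i} has-a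
  ... | p-a _ even = even
  ... | p-b () _
  ... | p-c ()

  a∈q⇒odd : ∀ {j} → HasColor {n} {s} (q j) a → toℕ j % 2 ≡ 1
  a∈q⇒odd {j} has-a with q-colours {j} has-a
  ... | q-a _ odd = odd
  ... | q-b () _
  ... | q-c ()

  pv-colours : ∀ {k col} → HasColor (pv k) col → (k < NP × PColour k col) ⊎ (NP ≤ k × col ≡ bP)
  pv-colours {k} {col} has with pv-cases k
  ... | inj₁ (k< , e) = inj₁ (k< , subst (λ x → PColour x col) (toℕ-fromℕ< k<) (p-colours (subst (λ u → HasColor u col) e has)))
  ... | inj₂ (NP≤ , e) with subst (λ u → HasColor u col) e has
  ...   | here col≡bP = inj₂ (NP≤ , col≡bP)

  qv-colours : ∀ {l col} → HasColor (qv l) col → (l < NQ × QColour l col) ⊎ col ≡ bP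
  qv-colours {l} {col} has with qv-cases l
  ... | inj₁ (l< , e) = inj₁ (l< , subst (λ x → QColour x col) (toℕ-fromℕ< l<) (q-colours (subst (λ u → HasColor u col) e has)))
  ... | inj₂ (_ , e) with subst (λ u → HasColor u col) e has
  ...   | here col≡bP = inj₂ col≡bP

  pv-colours-< : ∀ {k col} → k < NP → HasColor (pv k) col → PColour k col
  pv-colours-< {k} {col} k< has = subst (λ x → PColour x col) (toℕ-fromℕ< k<) (p-colours (subst (λ u → HasColor u col) (pv-< k<) has))

  qv-colours-< : ∀ {l col} → l < NQ → HasColor (qv l) col → QColour l col
  qv-colours-< {l} {col} l< has = subst (λ x → QColour x col) (toℕ-fromℕ< l<) (q-colours (subst (λ u → HasColor u col) (qv-< l<) has))

  c-mod-4 : ∀ {x y} → c (x mod 4) ≡ c (y mod 4) → x % 4 ≡ y % 4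
  c-mod-4 {x} {y} eq = fromℕ<-injective (x % 4) (y % 4) (m%n<n x 4) (m%n<n y 4) (c-injective eq)
    where
    c-injective : ∀ {i j} → c i ≡ c j → i ≡ j
    c-injective refl = refl

  PColour-shared : ∀ {k k′ col} → PColour k col → PColour k′ col → k % 2 ≡ k′ % 2 ⊎ k % 4 ≡ k′ % 4
  PColour-shared (p-a refl e) (p-a _ e′) = inj₁ (trans e (sym e′))
  PColour-shared (p-b refl o) (p-b _ o′) = inj₁ (trans o (sym o′))
  PColour-shared {k} {k′} (p-c refl) (p-c eq) = inj₂ (c-mod-4 {k} {k′} eq)
  PColour-shared (p-a refl _) (p-b () _)
  PColour-shared (p-a refl _) (p-c ())
  PColour-shared (p-b refl _) (p-a () _)
  PColour-shared (p-b refl _) (p-c ())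
  PColour-shared (p-c refl) (p-a () _)
  PColour-shared (p-c refl) (p-b () _)

  QColour-shared : ∀ {l l′ col} → QColour l col → QColour l′ col → l % 2 ≡ l′ % 2 ⊎ (l + 2) % 4 ≡ (l′ + 2) % 4
  QColour-shared (q-b refl e) (q-b _ e′) = inj₁ (trans e (sym e′))
  QColour-shared (q-a refl o) (q-a _ o′) = inj₁ (trans o (sym o′))
  QColour-shared {l} {l′} (q-c refl) (q-c eq) = inj₂ (c-mod-4 {l + 2} {l′ + 2} eq)
  QColour-shared (q-b refl _) (q-a () _)
  QColour-shared (q-b refl _) (q-c ())
  QColour-shared (q-a refl _) (q-b () _)
  QColour-shared (q-a refl _) (q-c ())
  QColour-shared (q-c refl) (q-b () _)
  QColour-shared (q-c refl) (q-a () _)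

  PQColour-shared : ∀ {k l col} → PColour k col → QColour l col → (k % 2 ≡ 0 × l % 2 ≡ 1) ⊎ k % 4 ≡ (l + 2) % 4
  PQColour-shared (p-a refl e) (q-a _ o) = inj₁ (e , o)
  PQColour-shared {k} {l} (p-c refl) (q-c eq) = inj₂ (c-mod-4 {k} {l + 2} eq)
  PQColour-shared (p-a refl _) (q-b () _)
  PQColour-shared (p-a refl _) (q-c ())
  PQColour-shared (p-b refl _) (q-b () _)
  PQColour-shared (p-b refl _) (q-a () _)
  PQColour-shared (p-b refl _) (q-c ())
  PQColour-shared (p-c refl) (q-b () _)
  PQColour-shared (p-c refl) (q-a () _)

  Q-has-no-bP : ∀ {l} → ¬ QColour l bP
  Q-has-no-bP (q-b () _)
  Q-has-no-bP (q-a () _)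
  Q-has-no-bP (q-c ())

  module Forward (G : Triangulation n s) (proper : ProperlyMulticolored G) where
    open Paths (adj G) (symm G)

    clash : ∀ {u v col} → u ~ v → HasColor u col → HasColor v col → ⊥
    clash {u} {v} {col} u~v = proper u v u~v col

    p~p⇒parity≢ : ∀ {k k′} → k < NP → k′ < NP → pv k ~ pv k′ → k % 2 ≢ k′ % 2
    p~p⇒parity≢ {k} k< k′< k~k′ same with %2-cases k
    ... | inj₁ even = clash k~k′ (pv-colour k< (p-a refl even)) (pv-colour k′< (p-a refl (trans (sym same) even)))
    ... | inj₂ odd  = clash k~k′ (pv-colour k< (p-b refl odd)) (pv-colour k′< (p-b refl (trans (sym same) odd)))

    q~q⇒parity≢ : ∀ {l l′} → l < NQ → l′ < NQ → qv l ~ qv l′ → l % 2 ≢ l′ % 2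
    q~q⇒parity≢ {l} l< l′< l~l′ same with %2-cases l
    ... | inj₁ even = clash l~l′ (qv-colour l< (q-b refl even)) (qv-colour l′< (q-b refl (trans (sym same) even)))
    ... | inj₂ odd  = clash l~l′ (qv-colour l< (q-a refl odd)) (qv-colour l′< (q-a refl (trans (sym same) odd)))

    bP~p⇒even : ∀ {u k} → HasColor u bP → k < NP → u ~ pv k → k % 2 ≡ 0
    bP~p⇒even {k = k} u-bP k< u~k with %2-cases k
    ... | inj₁ even = even
    ... | inj₂ odd  = ⊥-elim (clash u~k u-bP (pv-colour k< (p-b refl odd)))

    h≁t : ¬ h ~ t
    h≁t h~t = clash h~t (here refl) (here refl)

    p~q⇒even : ∀ {k l} → k < NP → l < NQ → pv k ~ qv l → k % 2 ≡ 0 → l % 2 ≡ 0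
    p~q⇒even {l = l} k< l< k~l even with %2-cases l
    ... | inj₁ l-even = l-even
    ... | inj₂ l-odd  = ⊥-elim (clash k~l (pv-colour k< (p-a refl even)) (qv-colour l< (q-a refl l-odd)))

    p~q⇒odd : ∀ {k l} → k < NP → l < NQ → pv k ~ qv l → l % 2 ≡ 1 → k % 2 ≡ 1
    p~q⇒odd {k} k< l< k~l l-odd with %2-cases k
    ... | inj₂ odd  = odd
    ... | inj₁ even = ⊥-elim (clash k~l (pv-colour k< (p-a refl even)) (qv-colour l< (q-a refl l-odd)))

    p~q⇒apart : ∀ {k l} → k < NP → l < NQ → pv k ~ qv l → (l + 2) % 4 ≢ k % 4
    p~q⇒apart {k} {l} k< l< k~l eq =
      clash k~l (pv-colour k< (p-c refl)) (qv-colour l< (q-c (cong c (fromℕ<-cong _ _ (sym eq) _ _))))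

    pv-walk : Walk NP pv
    pv-walk z z<NP with pv-cases (suc z)
    ... | inj₁ (z+1< , e) = subst₂ _~_ (sym (pv-< z<NP)) (sym e)
                              (super G _ _ (pp _ _ (trans (toℕ-fromℕ< z+1<) (cong suc (sym (toℕ-fromℕ< z<NP))))))
    ... | inj₂ (NP≤z+1 , e) = subst₂ _~_ (sym (pv-< z<NP)) (sym e)
                              (~-sym (super G _ _ (tp _ (trans (cong suc (toℕ-fromℕ< z<NP)) (≤-antisym z<NP NP≤z+1)))))

    qv-walk : Walk NQ′ qv
    qv-walk z z<NQ′ = subst₂ _~_ (sym (qv-< z<NQ)) (sym (qv-< z+1<NQ))
                         (super G _ _ (qq _ _ (trans (toℕ-fromℕ< z+1<NQ) (cong suc (sym (toℕ-fromℕ< z<NQ))))))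
      where
      z+1<NQ : suc z < NQ
      z+1<NQ = subst (suc z <_) 1+NQ′≡NQ (s≤s z<NQ′)
      z<NQ : z < NQ
      z<NQ = <-trans (n<1+n z) z+1<NQ

    t~qv-last : t ~ qv NQ′
    t~qv-last = subst (t ~_) (sym (qv-< NQ′<NQ)) (super G _ _ (tq _ (trans (cong suc (toℕ-fromℕ< NQ′<NQ)) 1+NQ′≡NQ)))

    h~pv0 : h ~ pv 0
    h~pv0 = subst (h ~_) (sym (pv-< 0<NP)) (super G _ _ (hp _ (toℕ-fromℕ< 0<NP)))

    P-path : IsPath NP pv
    P-path = record { injective = λ _ _ → pv-injective ; walk = pv-walk }

    Q-path : IsPath NQ′ qv
    Q-path = record { injective = λ _ _ l≤ l′≤ → qv-injective (≤-<-trans l≤ NQ′<NQ) (≤-<-trans l′≤ NQ′<NQ) ; walk = qv-walk }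

    -- Three pairwise adjacent vertices would need three pairwise distinct parities.
    P-chordless : ChordlessPath NP pv
    P-chordless = triangle-free⇒chordless (chordal G) P-path no-triangle
      where
      no-triangle : ∀ i j k → i < j → j < k → k ≤ NP → pv i ~ pv j → pv j ~ pv k → ¬ pv i ~ pv k
      no-triangle i j k i<j j<k k≤NP i~j j~k i~k with pv-cases k
      ... | inj₁ (k< , _) = three-parities i j k (p~p⇒parity≢ i< j< i~j) (p~p⇒parity≢ j< k< j~k) (p~p⇒parity≢ i< k< i~k)
        where
        j< : j < NP
        j< = <-trans j<k k<
        i< : i < NP
        i< = <-trans i<j j<
      ... | inj₂ (_ , k≡t) =
        p~p⇒parity≢ i< j< i~j (trans (bP~p⇒even t-bP i< (~-sym i~t)) (sym (bP~p⇒even t-bP j< (~-sym j~t))))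
        where
        j< : j < NP
        j< = <-≤-trans j<k k≤NP
        i< : i < NP
        i< = <-trans i<j j<
        t-bP : HasColor {n} {s} t bP
        t-bP = here refl
        i~t : pv i ~ t
        i~t = subst (pv i ~_) k≡t i~k
        j~t : pv j ~ t
        j~t = subst (pv j ~_) k≡t j~k

    Q-chordless : ChordlessPath NQ′ qv
    Q-chordless = triangle-free⇒chordless (chordal G) Q-path no-triangle
      where
      no-triangle : ∀ i j k → i < j → j < k → k ≤ NQ′ → qv i ~ qv j → qv j ~ qv k → ¬ qv i ~ qv k
      no-triangle i j k i<j j<k k≤NQ′ i~j j~k i~k =
        three-parities i j k (q~q⇒parity≢ i< j< i~j) (q~q⇒parity≢ j< k< j~k) (q~q⇒parity≢ i< k< i~k)
        where
        k< : k < NQ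
        k< = ≤-<-trans k≤NQ′ NQ′<NQ
        j< : j < NQ
        j< = <-trans j<k k<
        i< : i < NQ
        i< = <-trans i<j j<

    h~qv0 : h ~ qv 0
    h~qv0 = subst (h ~_) (sym (qv-< 0<NQ)) (super G _ _ (hq _ (toℕ-fromℕ< 0<NQ)))
      where
      0<NQ : 0 < NQ
      0<NQ = ≤-<-trans z≤n NP<NQ

    private
      Q-back : ℕ → V n s
      Q-back = append NQ′ (λ z → qv (NQ′ ∸ z)) (λ _ → h)

      gadget : ℕ → V n s
      gadget = append NP pv Q-back

      Q-back-values : ∀ w → w ≤ suc (NQ′ + 0) → (w ≤ NQ′ × Q-back w ≡ qv (NQ′ ∸ w)) ⊎ Q-back w ≡ h
      Q-back-values w w≤ with ≤⊎>-split NQ′ w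
      ... | inj₁ w≤NQ′ = inj₁ (w≤NQ′ , append-≤ NQ′ _ _ w w≤NQ′)
      ... | inj₂ (0 , refl) = inj₂ (append-> NQ′ _ _ 0)
      ... | inj₂ (suc k , refl) with () ← +-cancelˡ-≤ NQ′ (suc k) 0 (≤-pred w≤)

      gadget-closed : ClosedPath (suc (NP + suc (NQ′ + 0))) gadget
      gadget-closed = ClosedPath-append P-path Q-back-path P∉Q-back
        (subst₂ _~_ (sym (pv-≥ ≤-refl)) (sym (append-≤ NQ′ _ _ 0 z≤n)) t~qv-last)
        (subst (_~ pv 0) (sym (append-> NQ′ _ _ 0)) h~pv0)
        where
        Q-back-path : IsPath (suc (NQ′ + 0)) Q-back
        Q-back-path = IsPath-append (IsPath-reverse Q-path) (IsPath-point h)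
          (λ z _ _ _ → qv≢h (≤-<-trans (m∸n≤m NQ′ z) NQ′<NQ))
          (subst (_~ h) (cong qv (sym (n∸n≡0 NQ′))) (~-sym h~qv0))
        P∉Q-back : ∀ z w → z ≤ NP → w ≤ suc (NQ′ + 0) → pv z ≢ Q-back w
        P∉Q-back z w _ w≤ eq with Q-back-values w w≤
        ... | inj₁ (_ , e) = pv≢qv (≤-<-trans (m∸n≤m NQ′ w) NQ′<NQ) (trans eq e)
        ... | inj₂ e = pv≢h z (trans eq e)

    -- The apex over the closing edge h ~ pv 0 lies on Q by parity.
    first-rung : ∃[ l ] (l < NQ × pv 0 ~ qv l)
    first-rung with m , 0<m , m<r , p0~fm , fm~h ← apex (chordal G) _ gadget (s≤s (≤-trans (s≤s z≤n) (m≤n+m _ NP))) gadget-closed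
      with ≤⊎>-split NP m
    ... | inj₂ (w , refl) =
      NQ′ ∸ w , ≤-<-trans (m∸n≤m NQ′ w) NQ′<NQ ,
      subst₂ _~_ (append-≤ NP pv Q-back 0 z≤n) (trans (append-> NP pv Q-back w) (append-≤ NQ′ _ _ w w≤NQ′)) p0~fm
      where
      w≤NQ′ : w ≤ NQ′
      w≤NQ′ = subst (w ≤_) (+-identityʳ NQ′) (≤-pred (+-cancelˡ-< NP _ _ (≤-pred m<r)))
    ... | inj₁ m≤NP with pv-cases m
    ...   | inj₁ (m< , _) = ⊥-elim (p~p⇒parity≢ 0<NP m< p0~pm (sym (bP~p⇒even (here refl) m< (~-sym pm~h))))
      where
      p0~pm : pv 0 ~ pv m
      p0~pm = subst₂ _~_ (append-≤ NP pv Q-back 0 z≤n) (append-≤ NP pv Q-back m m≤NP) p0~fm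
      pm~h : pv m ~ h
      pm~h = subst₂ _~_ (append-≤ NP pv Q-back m m≤NP) (trans (append-> NP pv Q-back _) (append-> NQ′ _ _ 0)) fm~h
    ...   | inj₂ (_ , pm≡t) =
      ⊥-elim (h≁t (~-sym (subst₂ _~_ (trans (append-≤ NP pv Q-back m m≤NP) pm≡t)
                                    (trans (append-> NP pv Q-back _) (append-> NQ′ _ _ 0)) fm~h)))

    first-offset : ∃[ Δ ] (4 * Δ < NQ × pv 0 ~ qv (4 * Δ))
    first-offset with l , l< , p0~ql ← first-rung
      with Δ , refl ← even-not-2-mod-4 l (p~q⇒even 0<NP l< p0~ql refl) (p~q⇒apart 0<NP l< p0~ql) =
      Δ , l< , p0~ql

    p~q⇒l+2≢4u+k : ∀ {k l} → k < NP → l < NQ → pv k ~ qv l → ∀ u → l + 2 ≢ 4 * u + k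
    p~q⇒l+2≢4u+k {k} k< l< k~l u eq = p~q⇒apart k< l< k~l (trans (cong (_% 4) eq) ([4u+x]%4≡x%4 u k))

    Q-segment : ∀ l β → l + β ≤ NQ′ → ChordlessPath β (λ j → qv (l + j))
    Q-segment l β l+β≤NQ′ = ChordlessPath-segment l β l+β≤NQ′ Q-chordless

    -- The fan would give pv k two consecutive Q-neighbours, one of colour a.
    even-one-neighbour : ∀ {k l₁ l₂} → k < NP → k % 2 ≡ 0 → l₁ < l₂ → l₂ < NQ → pv k ~ qv l₁ → pv k ~ qv l₂ → ⊥
    even-one-neighbour {k} {l₁} {l₂} k< even l₁<l₂ l₂< k~l₁ k~l₂ =
      [1+x]%2≢x%2 l₁ (trans (p~q⇒even k< (≤-<-trans l₁<l₂ l₂<) k~l₁+1 even) (sym (p~q⇒even k< (<-trans l₁<l₂ l₂<) k~l₁ even)))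
      where
      β : ℕ
      β = l₂ ∸ l₁
      l₁+β≡l₂ : l₁ + β ≡ l₂
      l₁+β≡l₂ = m+[n∸m]≡n (<⇒≤ l₁<l₂)
      k~l₁+1 : pv k ~ qv (suc l₁)
      k~l₁+1 = subst (λ l → pv k ~ qv l) (+-comm l₁ 1)
        (fan (chordal G) (Q-segment l₁ β (subst (_≤ NQ′) (sym l₁+β≡l₂) (≤-pred (subst (l₂ <_) (sym 1+NQ′≡NQ) l₂<))))
          (λ j j≤β → pv≢qv {k} {l₁ + j} (≤-<-trans (subst (l₁ + j ≤_) l₁+β≡l₂ (+-monoʳ-≤ l₁ j≤β)) l₂<))
          (subst (λ l → pv k ~ qv l) (sym (+-identityʳ l₁)) k~l₁) (subst (λ l → pv k ~ qv l) (sym l₁+β≡l₂) k~l₂)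
          1 (m<n⇒0<n∸m l₁<l₂))

    module Offset (Δ : ℕ) (D<NQ : 4 * Δ < NQ) (p0~qD : pv 0 ~ qv (4 * Δ)) where
      D : ℕ
      D = 4 * Δ

      -- The rungs of the ladder between P and Q from pv 0 ~ qv D to t ~ qv NQ′
      -- join pv i and qv (D + j) with ∣ i - j ∣ ≤ 1: a difference of 2 would
      -- repeat a colour c.
      private
        β₀ : ℕ
        β₀ = NQ′ ∸ D

        D+β₀≡NQ′ : D + β₀ ≡ NQ′
        D+β₀≡NQ′ = m+[n∸m]≡n (≤-pred (subst (D <_) (sym 1+NQ′≡NQ) D<NQ))

        D+j< : ∀ {j} → j ≤ β₀ → D + j < NQ
        D+j< {j} j≤β = ≤-<-trans (subst (D + j ≤_) D+β₀≡NQ′ (+-monoʳ-≤ D j≤β)) NQ′<NQ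

        open Ladder (chordal G) P-chordless (ChordlessPath-segment D β₀ (≤-reflexive D+β₀≡NQ′) Q-chordless)
                    (λ _ _ _ j≤β → pv≢qv (D+j< j≤β)) (subst₂ _~_ (sym (pv-≥ ≤-refl)) (cong qv (sym D+β₀≡NQ′)) t~qv-last)

        Close : ℕ → ℕ → Set
        Close i j = i < NP → j ≤ suc i × i ≤ suc j

        close-x : ∀ i j → i < NP → j ≤ β₀ → Close i j → pv (suc i) ~ qv (D + j) → Close (suc i) j
        close-x i j i< j≤β close i+1~j i+1< with close i<
        ... | j≤i+1 , i≤j+1 with m≤n⇒m<n∨m≡n i≤j+1
        ...   | inj₁ i≤j = ≤-trans j≤i+1 (n≤1+n _) , i≤j
        ...   | inj₂ refl = ⊥-elim (p~q⇒l+2≢4u+k i+1< (D+j< j≤β) i+1~j Δ (reassoc Δ j))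
          where
          reassoc : ∀ Δ j → 4 * Δ + j + 2 ≡ 4 * Δ + suc (suc j)
          reassoc = solve-∀

        close-y : ∀ i j → i ≤ NP → j < β₀ → Close i j → pv i ~ qv (D + suc j) → Close i (suc j)
        close-y i j _ j<β close i~j+1 i< with close i<
        ... | j≤i+1 , i≤j+1 with m≤n⇒m<n∨m≡n j≤i+1
        ...   | inj₁ j≤i = j≤i , ≤-trans i≤j+1 (n≤1+n _)
        ...   | inj₂ refl = ⊥-elim (p~q⇒l+2≢4u+k i< (D+j< j<β) i~j+1 (suc Δ) (reassoc Δ i))
          where
          reassoc : ∀ Δ i → 4 * Δ + suc (suc i) + 2 ≡ 4 * suc Δ + i
          reassoc = solve-∀

        open Zip Close close-x close-y

      even-rung : ∀ {k} → k < NP → k % 2 ≡ 0 → D + k < NQ × pv k ~ qv (D + k)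
      even-rung {k} k< even
        with j , j≤β , k~j , close ←
               proj₂ (zip-from 0 0 z≤n z≤n (subst (λ l → pv 0 ~ qv l) (sym (+-identityʳ D)) p0~qD) (λ _ → z≤n , z≤n))
                     k z≤n (<⇒≤ k<)
        with refl ← same-parity-close⇒≡ (trans (sym ([4u+x]%2≡x%2 Δ j)) (trans (p~q⇒even k< (D+j< j≤β) k~j even) (sym even)))
                                        (proj₁ (close k<)) (proj₂ (close k<)) =
        D+j< j≤β , k~j

      even-rung-unique : ∀ {k l} → k < NP → k % 2 ≡ 0 → l < NQ → pv k ~ qv l → l ≡ D + k
      even-rung-unique {k} {l} k< even l< k~l = case <-cmp l (D + k) of λ where
          (tri≈ _ l≡ _)    → l≡
          (tri< l<D+k _ _) → ⊥-elim (even-one-neighbour k< even l<D+k D+k< k~l k~D+k)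
          (tri> _ _ D+k<l) → ⊥-elim (even-one-neighbour k< even D+k<l l< k~D+k k~l)
        where
        D+k< : D + k < NQ
        D+k< = proj₁ (even-rung k< even)
        k~D+k : pv k ~ qv (D + k)
        k~D+k = proj₂ (even-rung k< even)

      private
        InQ : ℕ → (ℕ → V n s) → Set
        InQ β y = ∀ j → j ≤ β → ∃[ l ] (l < NQ × y j ≡ qv l)

      -- By the corner lemma pv k sees y 0, and then all of y by the fan.
      odd-spreads : ∀ {k k′ β y} → ChordlessPath β y → InQ β y → 1 ≤ β → k < NP → k′ < NP → k′ % 2 ≡ 0 →
                    pv k ~ pv k′ → y 0 ≡ qv (D + k′) → y β ~ pv k → pv k ~ y 1
      odd-spreads {k} {k′} {β} {y} y-path in-Q 1≤β k< k′< even k~k′ y0≡ yβ~k =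
        fan (chordal G) y-path (λ j j≤β → proj₂ (off-y j j≤β)) k~y0 (~-sym yβ~k) 1 1≤β
        where
        open ChordlessPath y-path using (injective)
        off-y : ∀ j → j ≤ β → pv k′ ≢ y j × pv k ≢ y j
        off-y j j≤β with l , l< , e ← in-Q j j≤β = (λ eq → pv≢qv {k′} {l} l< (trans eq e)) , (λ eq → pv≢qv {k} {l} l< (trans eq e))
        k′-sees-only-y0 : ∀ j → j ≤ β → pv k′ ~ y j → j ≡ 0
        k′-sees-only-y0 j j≤β k′~yj with l , l< , e ← in-Q j j≤β =
          injective j 0 j≤β z≤n (trans e (trans (cong qv (even-rung-unique k′< even l< (subst (pv k′ ~_) e k′~yj))) (sym y0≡)))
        k′≢k : pv k′ ≢ pv k
        k′≢k eq = p~p⇒parity≢ k< k′< k~k′ (cong (_% 2) (sym (pv-injective {k′} {k} (<⇒≤ k′<) (<⇒≤ k<) eq)))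
        k~y0 : pv k ~ y 0
        k~y0 = corner (chordal G) y-path off-y k~k′ (subst (pv k′ ~_) (sym y0≡) (proj₂ (even-rung k′< even))) yβ~k k′≢k k′-sees-only-y0

      private
        long-rung-right : ∀ {k l} → k < NP → k % 2 ≡ 1 → l < NQ → pv k ~ qv l → D + k + 3 < l → ⊥
        long-rung-right {k} {l} k< odd l< k~l D+k+3<l =
          p~q⇒l+2≢4u+k k< (y< 1 1≤β) (odd-spreads y-path (λ j j≤β → l₀ + j , y< j j≤β , refl) 1≤β k< k+1< k+1-even
                                        (pv-walk k k<) (cong qv (+-identityʳ l₀)) yβ~k) (suc Δ) (reassoc Δ k)
          where
          l₀ : ℕ
          l₀ = D + suc k
          k+1< : suc k < NP
          k+1< = odd⇒suc<NP k< odd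
          k+1-even : suc k % 2 ≡ 0
          k+1-even = trans ([1+x]%2≡1∸x%2 k) (cong (1 ∸_) odd)
          l₀<l : l₀ < l
          l₀<l = ≤-trans (≤-reflexive (shift D k)) (≤-trans (m≤m+n (suc (suc (D + k))) 2) (≤-trans (≤-reflexive (shift′ D k)) D+k+3<l))
            where
            shift : ∀ D k → suc (D + suc k) ≡ suc (suc (D + k))
            shift = solve-∀
            shift′ : ∀ D k → suc (suc (D + k)) + 2 ≡ suc (D + k + 3)
            shift′ = solve-∀
          β : ℕ
          β = l ∸ l₀
          l₀+β≡l : l₀ + β ≡ l
          l₀+β≡l = m+[n∸m]≡n (<⇒≤ l₀<l)
          1≤β : 1 ≤ β
          1≤β = m<n⇒0<n∸m l₀<l
          y< : ∀ j → j ≤ β → l₀ + j < NQ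
          y< j j≤β = ≤-<-trans (subst (l₀ + j ≤_) l₀+β≡l (+-monoʳ-≤ l₀ j≤β)) l<
          y-path : ChordlessPath β (λ j → qv (l₀ + j))
          y-path = Q-segment l₀ β (subst (_≤ NQ′) (sym l₀+β≡l) (≤-pred (subst (l <_) (sym 1+NQ′≡NQ) l<)))
          yβ~k : qv (l₀ + β) ~ pv k
          yβ~k = subst (λ l → qv l ~ pv k) (sym l₀+β≡l) (~-sym k~l)
          reassoc : ∀ Δ k → 4 * Δ + suc k + 1 + 2 ≡ 4 * suc Δ + k
          reassoc = solve-∀

        long-rung-left : ∀ {k l} → k < NP → k % 2 ≡ 1 → l < NQ → pv k ~ qv l → l + 3 < D + k → ⊥
        long-rung-left {zero} _ ()
        long-rung-left {suc k₀} {l} k< odd l< k~l l+3<D+k =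
          p~q⇒l+2≢4u+k k< (y< 1 1≤β) (odd-spreads y-path (λ j j≤β → l + (β ∸ j) , y< j j≤β , refl) 1≤β k< k₀< k₀-even
                                        (~-sym (pv-walk k₀ k₀<)) (cong qv l+β≡D+k₀) yβ~k) Δ y1+2≡
          where
          k₀< : k₀ < NP
          k₀< = <-trans (n<1+n k₀) k<
          k₀-even : k₀ % 2 ≡ 0
          k₀-even with %2-cases k₀
          ... | inj₁ even = even
          ... | inj₂ odd₀ = ⊥-elim ([1+x]%2≢x%2 k₀ (trans odd (sym odd₀)))
          D+k₀< : D + k₀ < NQ
          D+k₀< = proj₁ (even-rung k₀< k₀-even)
          l+3≤D+k₀ : l + 3 ≤ D + k₀
          l+3≤D+k₀ = ≤-pred (subst (l + 3 <_) (+-suc D k₀) l+3<D+k)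
          β : ℕ
          β = D + k₀ ∸ l
          l+β≡D+k₀ : l + β ≡ D + k₀
          l+β≡D+k₀ = m+[n∸m]≡n (≤-trans (m≤m+n l 3) l+3≤D+k₀)
          1≤β : 1 ≤ β
          1≤β = m<n⇒0<n∸m (<-≤-trans (m<m+n l (s≤s z≤n)) l+3≤D+k₀)
          y< : ∀ j → j ≤ β → l + (β ∸ j) < NQ
          y< j _ = ≤-<-trans (subst (l + (β ∸ j) ≤_) l+β≡D+k₀ (+-monoʳ-≤ l (m∸n≤m β j))) D+k₀<
          y-path : ChordlessPath β (λ j → qv (l + (β ∸ j)))
          y-path = ChordlessPath-reverse (Q-segment l β (subst (_≤ NQ′) (sym l+β≡D+k₀) (≤-pred (subst (D + k₀ <_) (sym 1+NQ′≡NQ) D+k₀<))))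
          yβ~k : qv (l + (β ∸ β)) ~ pv (suc k₀)
          yβ~k = subst (λ j → qv j ~ pv (suc k₀)) (sym (trans (cong (l +_) (n∸n≡0 β)) (+-identityʳ l))) (~-sym k~l)
          y1+2≡ : l + (β ∸ 1) + 2 ≡ 4 * Δ + suc k₀
          y1+2≡ = begin
            l + (β ∸ 1) + 2       ≡⟨ +-suc (l + (β ∸ 1)) 1 ⟩
            suc (l + (β ∸ 1) + 1) ≡⟨ cong suc (+-assoc l (β ∸ 1) 1) ⟩
            suc (l + (β ∸ 1 + 1)) ≡⟨ cong (λ b → suc (l + b)) (m∸n+n≡m 1≤β) ⟩
            suc (l + β)           ≡⟨ cong suc l+β≡D+k₀ ⟩
            suc (D + k₀)          ≡⟨ sym (+-suc D k₀) ⟩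
            D + suc k₀            ∎
            where open ≡-Reasoning

      -- l agrees with D + k mod 4, and a longer rung would spread (odd-spreads)
      -- to a Q-vertex with pv k's colour c.
      odd-rung-unique : ∀ {k l} → k < NP → l < NQ → pv k ~ qv l → l % 2 ≡ 1 → l ≡ D + k
      odd-rung-unique {k} {l} k< l< k~l l-odd =
        close-mod-4⇒≡ {l} {D + k} same-mod-4 (≮⇒≥ (long-rung-right k< k-odd l< k~l)) (≮⇒≥ (long-rung-left k< k-odd l< k~l))
        where
        k-odd : k % 2 ≡ 1
        k-odd = p~q⇒odd k< l< k~l l-odd
        same-mod-4 : l % 4 ≡ (D + k) % 4
        same-mod-4 = trans (odd-not-opposite-mod-4 l k l-odd k-odd (p~q⇒apart k< l< k~l)) (sym ([4u+x]%4≡x%4 Δ k))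

      -- The rung of the last even vertex pv (NP - 1) must fit into Q.
      Δ≤s : Δ ≤ s
      Δ≤s = ≤-pred (*-cancelˡ-< 4 Δ (suc s) (≤-trans (s≤s D≤4s+1) (≤-trans (m≤m+n _ 2) (≤-reflexive (reassoc s)))))
        where
        kL : ℕ
        kL = NP ∸ 1
        kL+1≡NP : suc kL ≡ NP
        kL+1≡NP = trans (+-comm 1 kL) (m∸n+n≡m {NP} {1} (≤-trans (s≤s z≤n) 3≤NP))
        kL-even : kL % 2 ≡ 0
        kL-even with %2-cases kL
        ... | inj₁ even = even
        ... | inj₂ odd = ⊥-elim ([1+x]%2≢x%2 kL (trans (cong (_% 2) kL+1≡NP) (trans NP-odd (sym odd))))
        D+4n≤ : D + 4 * n ≤ 4 * n + (4 * s + 1)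
        D+4n≤ = subst₂ _≤_ eqL eqR (s≤s (proj₁ (even-rung (subst (kL <_) kL+1≡NP ≤-refl) kL-even)))
          where
          eqL : suc (suc (D + kL)) ≡ D + 4 * n
          eqL = trans (sym (trans (+-suc D (suc kL)) (cong suc (+-suc D kL))))
                      (trans (cong (λ m → D + suc m) kL+1≡NP) (cong (D +_) (trans (+-comm 1 NP) NP+1≡4n)))
          eqR : suc NQ ≡ 4 * n + (4 * s + 1)
          eqR = trans (cong suc (*-distribˡ-+ 4 n s)) (trans (+-comm 1 (4 * n + 4 * s)) (+-assoc (4 * n) (4 * s) 1))
        reassoc : ∀ s → suc (4 * s + 1) + 2 ≡ 4 * suc s
        reassoc = solve-∀
        D≤4s+1 : D ≤ 4 * s + 1
        D≤4s+1 = +-cancelˡ-≤ (4 * n) D (4 * s + 1) (subst (_≤ 4 * n + (4 * s + 1)) (+-comm D (4 * n)) D+4n≤)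

      rung-with-a : ∀ {i j} → pv (toℕ i) ~ qv (toℕ j) → HasColor {n} {s} (p i) a ⊎ HasColor {n} {s} (q j) a → toℕ j ≡ D + toℕ i
      rung-with-a {i} {j} i~j (inj₁ p-has-a) = even-rung-unique {toℕ i} {toℕ j} (toℕ<n i) (a∈p⇒even {i} p-has-a) (toℕ<n j) i~j
      rung-with-a {i} {j} i~j (inj₂ q-has-a) = odd-rung-unique {toℕ i} {toℕ j} (toℕ<n i) (toℕ<n j) i~j (a∈q⇒odd {j} q-has-a)

      -- Tooth i of P contains the even vertex pv (4 (i - 1)).
      has-offset : HasOffset G Δ
      has-offset zero () _
      has-offset (suc i₀) _ i≤n = locked , only
        where
        k : ℕ
        k = 4 * i₀
        k< : k < NP
        k< = +-cancelʳ-≤ 1 (suc k) NP (subst (suc k + 1 ≤_) (sym NP+1≡4n)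
               (≤-trans (m≤m+n (suc k + 1) 2) (≤-trans (≤-reflexive (reassoc i₀)) (*-monoʳ-≤ 4 i≤n))))
          where
          reassoc : ∀ i₀ → suc (4 * i₀) + 1 + 2 ≡ 4 * suc i₀
          reassoc = solve-∀
        k-even : k % 2 ≡ 0
        k-even = trans (cong (_% 2) (sym (+-identityʳ k))) ([4u+x]%2≡x%2 i₀ 0)
        k/4≡i₀ : k / 4 ≡ i₀
        k/4≡i₀ = trans (cong (_/ 4) (*-comm 4 i₀)) (m*n/n≡m i₀ 4)
        D+k< : D + k < NQ
        D+k< = proj₁ (even-rung k< k-even)
        locked : Locked G (suc i₀) (suc i₀ + Δ)
        locked = p (fromℕ< k<) , q (fromℕ< D+k<) ,
                 cong suc (trans (cong (_/ 4) (toℕ-fromℕ< k<)) k/4≡i₀) ,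
                 cong suc (trans (cong (_/ 4) (toℕ-fromℕ< D+k<)) (trans ([4Δ+k]/4≡Δ+k/4 Δ k) (trans (cong (Δ +_) k/4≡i₀) (+-comm Δ i₀)))) ,
                 subst₂ _~_ (pv-< k<) (qv-< D+k<) (proj₂ (even-rung k< k-even)) ,
                 inj₁ (subst (λ u → HasColor u a) (pv-< k<) (pv-colour k< (p-a refl k-even)))
        only : ∀ j → 1 ≤ j → j ≤ n + s → Locked G (suc i₀) j → j ≡ suc i₀ + Δ
        only _ _ _ (h , _ , () , _)
        only _ _ _ (t , _ , () , _)
        only _ _ _ (q _ , _ , () , _)
        only _ _ _ (p _ , h , _ , () , _)
        only _ _ _ (p _ , t , _ , () , _)
        only _ _ _ (p _ , p _ , _ , () , _)
        only _ _ _ (p i , q j , i-in-tooth , refl , i~j , a-end) = cong suc (begin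
          toℕ j / 4            ≡⟨ cong (_/ 4) (rung-with-a {i} {j} (subst₂ _~_ (sym (pv-toℕ i)) (sym (qv-toℕ j)) i~j) a-end) ⟩
          (D + toℕ i) / 4      ≡⟨ [4Δ+k]/4≡Δ+k/4 Δ (toℕ i) ⟩
          Δ + toℕ i / 4        ≡⟨ cong (Δ +_) (suc-injective i-in-tooth) ⟩
          Δ + i₀               ≡⟨ +-comm Δ i₀ ⟩
          i₀ + Δ               ∎)
          where open ≡-Reasoning

    forward : ∃[ Δ ] (Δ ≤ s × HasOffset G Δ)
    forward = let Δ , D< , p0~qD = first-offset in Δ , Offset.Δ≤s Δ D< p0~qD , Offset.has-offset Δ D< p0~qD

  -- The triangulation with offset Δ, given by an elimination ordering in which
  -- every vertex has at most the two later neighbours up₁ and up₂.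
  module Construction (Δ : ℕ) (Δ≤s : Δ ≤ s) where
    D : ℕ
    D = 4 * Δ

    D+NP<NQ : D + NP < NQ
    D+NP<NQ = begin
      suc (D + NP)    ≡⟨ sym (+-suc D NP) ⟩
      D + suc NP      ≡⟨ cong (D +_) (trans (+-comm 1 NP) NP+1≡4n) ⟩
      D + 4 * n       ≤⟨ +-monoˡ-≤ (4 * n) (*-monoʳ-≤ 4 Δ≤s) ⟩
      4 * s + 4 * n   ≡⟨ sym (*-distribˡ-+ 4 s n) ⟩
      4 * (s + n)     ≡⟨ cong (4 *_) (+-comm s n) ⟩
      NQ              ∎
      where open ≤-Reasoning

    D<NQ : D < NQ
    D<NQ = ≤-<-trans (m≤m+n D NP) D+NP<NQ

    D-split : ∀ l → l < D ⊎ ∃[ m ] (l ≡ D + m)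
    D-split l with l <? D
    ... | yes l<D = inj₁ l<D
    ... | no l≮D  = inj₂ (l ∸ D , sym (m+[n∸m]≡n (≮⇒≥ l≮D)))

    q-up₂ : ℕ → V n s
    q-up₂ l with l <? D
    ... | yes _ = h
    ... | no _  = pv (odd-ceil (l ∸ D))

    q-up₂-< : ∀ {l} → l < D → q-up₂ l ≡ h
    q-up₂-< {l} l<D with l <? D
    ... | yes _ = refl
    ... | no l≮D = ⊥-elim (l≮D l<D)

    q-up₂-+ : ∀ m → q-up₂ (D + m) ≡ pv (odd-ceil m)
    q-up₂-+ m with D + m <? D
    ... | yes D+m<D = ⊥-elim (<-irrefl refl (<-≤-trans D+m<D (m≤m+n D m)))
    ... | no _ = cong (pv ∘′ odd-ceil) (m+n∸m≡n D m)

    up₁ up₂ : V n s → V n s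
    up₁ h     = qv D
    up₁ t     = t
    up₁ (p i) = pv (suc (toℕ i))
    up₁ (q j) = qv (suc (toℕ j))
    up₂ h     = pv 0
    up₂ t     = t
    up₂ (p i) = qv (D + even-ceil (toℕ i))
    up₂ (q j) = q-up₂ (toℕ j)

    _≟V_ : (u v : V n s) → Dec (u ≡ v)
    h   ≟V h   = yes refl
    t   ≟V t   = yes refl
    p i ≟V p j = map′ (cong p) (λ { refl → refl }) (i ≟ᶠ j)
    q i ≟V q j = map′ (cong q) (λ { refl → refl }) (i ≟ᶠ j)
    h   ≟V t   = no λ ()
    h   ≟V p _ = no λ ()
    h   ≟V q _ = no λ ()
    t   ≟V h   = no λ ()
    t   ≟V p _ = no λ ()
    t   ≟V q _ = no λ ()
    p _ ≟V h   = no λ ()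
    p _ ≟V t   = no λ ()
    p _ ≟V q _ = no λ ()
    q _ ≟V h   = no λ ()
    q _ ≟V t   = no λ ()
    q _ ≟V p _ = no λ ()

    Above : V n s → V n s → Set
    Above u v = v ≡ up₁ u ⊎ v ≡ up₂ u

    Adj : V n s → V n s → Set
    Adj u v = u ≢ v × (Above u v ⊎ Above v u)

    Adj? : ∀ u v → Dec (Adj u v)
    Adj? u v = ¬? (u ≟V v) ×-dec ((v ≟V up₁ u ⊎-dec v ≟V up₂ u) ⊎-dec (u ≟V up₁ v ⊎-dec u ≟V up₂ v))

    adjacency : V n s → V n s → Bool
    adjacency u v = ⌊ Adj? u v ⌋

    Adj-sym : ∀ {u v} → Adj u v → Adj v u
    Adj-sym (u≢v , above) = u≢v ∘′ sym , Data.Sum.swap above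

    adjacency-sym : ∀ u v → adjacency u v ≡ adjacency v u
    adjacency-sym u v = ⇔→≡ {z = true} (mk⇔ (to u v) (to v u))
      where
      to : ∀ u v → adjacency u v ≡ true → adjacency v u ≡ true
      to u v eq = Equivalence.to T-≡ (fromWitness (Adj-sym (toWitness (Equivalence.from T-≡ eq))))

    adjacency-irrefl : ∀ v → adjacency v v ≡ false
    adjacency-irrefl v with Adj? v v
    ... | yes (v≢v , _) = ⊥-elim (v≢v refl)
    ... | no _ = refl

    top : ℕ
    top = D + 2 + 2 * (NP + NQ)

    rank-of-q : ℕ → ℕ
    rank-of-q l with l <? D
    ... | yes _ = l
    ... | no _  = D + 1 + q-rank (l ∸ D)

    q-rank′-< : ∀ {l} → l < D → rank-of-q l ≡ l
    q-rank′-< {l} l<D with l <? D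
    ... | yes _ = refl
    ... | no l≮D = ⊥-elim (l≮D l<D)

    q-rank′-+ : ∀ m → rank-of-q (D + m) ≡ D + 1 + q-rank m
    q-rank′-+ m with D + m <? D
    ... | yes D+m<D = ⊥-elim (<-irrefl refl (<-≤-trans D+m<D (m≤m+n D m)))
    ... | no _ = cong (λ m′ → D + 1 + q-rank m′) (m+n∸m≡n D m)

    rank : V n s → ℕ
    rank h     = D
    rank t     = top
    rank (p i) = D + 1 + p-rank (toℕ i)
    rank (q j) = rank-of-q (toℕ j)

    D<D+1+x : ∀ x → D < D + 1 + x
    D<D+1+x x = subst (_≤ D + 1 + x) (+-comm D 1) (m≤m+n (D + 1) x)

    D+1+x<top : ∀ {x} → x ≤ 2 * (NP + NQ) → D + 1 + x < top
    D+1+x<top {x} x≤ = ≤-trans (s≤s (+-monoʳ-≤ (D + 1) x≤)) (≤-reflexive (reassoc D (NP + NQ)))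
      where
      reassoc : ∀ D N → suc (D + 1 + 2 * N) ≡ D + 2 + 2 * N
      reassoc = solve-∀

    rank<top : ∀ v → v ≢ t → rank v < top
    rank<top h _ = <-trans (D<D+1+x 0) (D+1+x<top z≤n)
    rank<top t t≢t = ⊥-elim (t≢t refl)
    rank<top (p i) _ = D+1+x<top (≤-trans (<⇒≤ (p-rank<2[1+k] (toℕ i))) (*-monoʳ-≤ 2 (≤-trans (toℕ<n i) (m≤m+n NP NQ))))
    rank<top (q j) _ with D-split (toℕ j)
    ... | inj₁ j<D = subst (_< top) (sym (q-rank′-< j<D)) (<-trans j<D (rank<top h (λ ())))
    ... | inj₂ (m , j≡D+m) = subst (_< top) (sym (trans (cong rank-of-q j≡D+m) (q-rank′-+ m)))
            (D+1+x<top (≤-trans (<⇒≤ (q-rank<2[1+m] m)) (*-monoʳ-≤ 2 (≤-trans m<NQ (m≤n+m NQ NP)))))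
      where
      m<NQ : suc m ≤ NQ
      m<NQ = ≤-trans (s≤s (m≤n+m m D)) (subst (_≤ NQ) (cong suc j≡D+m) (toℕ<n j))

    q-rank′-cases : ∀ l → (l < D × rank-of-q l ≡ l) ⊎ ∃[ m ] (l ≡ D + m × rank-of-q l ≡ D + 1 + q-rank m)
    q-rank′-cases l with D-split l
    ... | inj₁ l<D = inj₁ (l<D , q-rank′-< l<D)
    ... | inj₂ (m , refl) = inj₂ (m , refl , q-rank′-+ m)

    below-D≢ : ∀ {l x} → l < D → l ≢ D + 1 + x
    below-D≢ {x = x} l<D refl = <-irrefl refl (<-trans l<D (D<D+1+x x))

    rank-injective : ∀ u v → rank u ≡ rank v → u ≡ v
    rank-injective h h _ = refl
    rank-injective t t _ = refl
    rank-injective h t eq = ⊥-elim (<-irrefl eq (rank<top h (λ ())))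
    rank-injective (p i) t eq = ⊥-elim (<-irrefl eq (rank<top (p i) (λ ())))
    rank-injective (q j) t eq = ⊥-elim (<-irrefl eq (rank<top (q j) (λ ())))
    rank-injective t h eq = sym (rank-injective h t (sym eq))
    rank-injective t (p i) eq = sym (rank-injective (p i) t (sym eq))
    rank-injective t (q j) eq = sym (rank-injective (q j) t (sym eq))
    rank-injective h (p i) eq = ⊥-elim (<-irrefl eq (D<D+1+x _))
    rank-injective h (q j) eq with q-rank′-cases (toℕ j)
    ... | inj₁ (j<D , r≡) = ⊥-elim (<-irrefl (sym (trans eq r≡)) j<D)
    ... | inj₂ (m , _ , r≡) = ⊥-elim (<-irrefl (trans eq r≡) (D<D+1+x _))
    rank-injective (p i) h eq = sym (rank-injective h (p i) (sym eq))
    rank-injective (q j) h eq = sym (rank-injective h (q j) (sym eq))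
    rank-injective (p i) (p i′) eq = cong p (toℕ-injective (p-rank-injective (+-cancelˡ-≡ (D + 1) _ _ eq)))
    rank-injective (p i) (q j) eq with q-rank′-cases (toℕ j)
    ... | inj₁ (j<D , r≡) = ⊥-elim (below-D≢ j<D (sym (trans eq r≡)))
    ... | inj₂ (m , _ , r≡) = ⊥-elim (p-rank≢q-rank (toℕ i) m (+-cancelˡ-≡ (D + 1) _ _ (trans eq r≡)))
    rank-injective (q j) (p i) eq = sym (rank-injective (p i) (q j) (sym eq))
    rank-injective (q j) (q j′) eq with q-rank′-cases (toℕ j) | q-rank′-cases (toℕ j′)
    ... | inj₁ (_ , r≡) | inj₁ (_ , r′≡) = cong q (toℕ-injective (trans (sym r≡) (trans eq r′≡)))
    ... | inj₁ (j<D , r≡) | inj₂ (_ , _ , r′≡) = ⊥-elim (below-D≢ j<D (trans (sym r≡) (trans eq r′≡)))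
    ... | inj₂ (_ , _ , r≡) | inj₁ (j′<D , r′≡) = ⊥-elim (below-D≢ j′<D (trans (sym r′≡) (trans (sym eq) r≡)))
    ... | inj₂ (m , j≡ , r≡) | inj₂ (m′ , j′≡ , r′≡) =
      cong q (toℕ-injective (trans j≡ (trans (cong (D +_) (q-rank-injective (+-cancelˡ-≡ (D + 1) _ _ (trans (sym r≡) (trans eq r′≡))))) (sym j′≡))))

    rank-pv : ∀ {x r} → (x < NP → r < D + 1 + p-rank x) → r < top → r < rank (pv x)
    rank-pv {x} {r} below below-top with pv-cases x
    ... | inj₁ (x< , e) = subst (λ u → r < rank u) (sym e) (subst (λ y → r < D + 1 + p-rank y) (sym (toℕ-fromℕ< x<)) (below x<))
    ... | inj₂ (_ , e) = subst (λ u → r < rank u) (sym e) below-top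

    rank-qv : ∀ {x r} → (x < NQ → r < rank-of-q x) → r < top → r < rank (qv x)
    rank-qv {x} {r} below below-top with qv-cases x
    ... | inj₁ (x< , e) = subst (λ u → r < rank u) (sym e) (subst (λ y → r < rank-of-q y) (sym (toℕ-fromℕ< x<)) (below x<))
    ... | inj₂ (_ , e) = subst (λ u → r < rank u) (sym e) below-top

    up₁-rank : ∀ v → v ≢ t → rank v < rank (up₁ v)
    up₁-rank h _ = rank-qv (λ _ → subst (D <_) (sym (trans (cong rank-of-q (sym (+-identityʳ D))) (q-rank′-+ 0))) (D<D+1+x _)) (rank<top h (λ ()))
    up₁-rank t t≢t = ⊥-elim (t≢t refl)
    up₁-rank (p i) _ = rank-pv (λ _ → +-monoʳ-< (D + 1) (p-rank-suc (toℕ i))) (rank<top (p i) (λ ()))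
    up₁-rank (q j) _ = rank-qv (λ _ → step (q-rank′-cases (toℕ j)) (q-rank′-cases (suc (toℕ j)))) (rank<top (q j) (λ ()))
      where
      step : ∀ {l} → (l < D × rank-of-q l ≡ l) ⊎ ∃[ m ] (l ≡ D + m × rank-of-q l ≡ D + 1 + q-rank m) →
             (suc l < D × rank-of-q (suc l) ≡ suc l) ⊎ ∃[ m ] (suc l ≡ D + m × rank-of-q (suc l) ≡ D + 1 + q-rank m) →
             rank-of-q l < rank-of-q (suc l)
      step (inj₁ (_ , r≡)) (inj₁ (_ , r′≡)) = subst₂ _<_ (sym r≡) (sym r′≡) ≤-refl
      step (inj₁ (l<D , r≡)) (inj₂ (_ , _ , r′≡)) = subst₂ _<_ (sym r≡) (sym r′≡) (<-trans l<D (D<D+1+x _))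
      step (inj₂ (m , refl , _)) (inj₁ (D+m+1<D , _)) = ⊥-elim (<-irrefl refl (<-≤-trans D+m+1<D (≤-trans (m≤m+n D m) (n≤1+n _))))
      step {l} (inj₂ (m , refl , r≡)) (inj₂ (m′ , eq , r′≡)) = subst₂ _<_ (sym r≡) (sym r′≡)
        (+-monoʳ-< (D + 1) (subst (λ m″ → q-rank m < q-rank m″) m′≡ (q-rank-suc m)))
        where
        m′≡ : suc m ≡ m′
        m′≡ = +-cancelˡ-≡ D _ _ (trans (+-suc D m) eq)

    up₂-rank : ∀ v → v ≢ t → rank v < rank (up₂ v)
    up₂-rank h _ = rank-pv (λ _ → D<D+1+x _) (rank<top h (λ ()))
    up₂-rank t t≢t = ⊥-elim (t≢t refl)
    up₂-rank (p i) _ = rank-qv (λ _ → subst (D + 1 + p-rank (toℕ i) <_) (sym (q-rank′-+ _)) (+-monoʳ-< (D + 1) (p-rank<q-rank-even-ceil (toℕ i))))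
                         (rank<top (p i) (λ ()))
    up₂-rank (q j) _ with q-rank′-cases (toℕ j)
    ... | inj₁ (j<D , r≡) = subst₂ (λ r u → r < rank u) (sym r≡) (sym (q-up₂-< j<D)) j<D
    ... | inj₂ (m , j≡ , r≡) = subst₂ (λ r u → r < rank u) (sym r≡) (sym (trans (cong q-up₂ j≡) (q-up₂-+ m)))
            (rank-pv (λ _ → +-monoʳ-< (D + 1) (q-rank<p-rank-odd-ceil m)) (subst (_< top) r≡ (rank<top (q j) (λ ()))))

    Above-rank : ∀ {u v} → u ≢ v → Above u v → rank u < rank v
    Above-rank {u} u≢v above with u ≟V t
    ... | yes refl = ⊥-elim (u≢v ([ sym , sym ]′ above))
    ... | no u≢t = [ (λ eq → subst (λ w → rank u < rank w) (sym eq) (up₁-rank u u≢t))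
                   , (λ eq → subst (λ w → rank u < rank w) (sym eq) (up₂-rank u u≢t)) ]′ above

    higher-neighbour-above : ∀ {v u} → Adj v u → rank v < rank u → Above v u
    higher-neighbour-above (_ , inj₁ above) _ = above
    higher-neighbour-above (v≢u , inj₂ above) v<u = ⊥-elim (<-asym v<u (Above-rank (v≢u ∘′ sym) above))

    up₂-pv : ∀ {x} → x < NP → up₂ (pv x) ≡ qv (D + even-ceil x)
    up₂-pv {x} x< = trans (cong up₂ (pv-< x<)) (cong (λ y → qv (D + even-ceil y)) (toℕ-fromℕ< x<))

    up₂-qv : ∀ {x} → x < NQ → up₂ (qv x) ≡ q-up₂ x
    up₂-qv {x} x< = trans (cong up₂ (qv-< x<)) (cong q-up₂ (toℕ-fromℕ< x<))

    private
      D+even-ceil<NQ : ∀ {k} → k < NP → k % 2 ≡ 0 → D + even-ceil k < NQ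
      D+even-ceil<NQ {k} k< even = subst (λ y → D + y < NQ) (sym (even-ceil-even even)) (<-trans (+-monoʳ-< D k<) D+NP<NQ)

      uppers-adjacent-high : ∀ m → qv (suc (D + m)) ≢ pv (odd-ceil m) → Adj (qv (suc (D + m))) (pv (odd-ceil m))
      uppers-adjacent-high m ne with %2-cases m
      ... | inj₁ even with qv-cases (suc (D + m))
      ...   | inj₁ (lt , _) = ne , inj₁ (inj₂ (trans (cong pv (odd-ceil-even even)) (sym (begin
                up₂ (qv (suc (D + m)))  ≡⟨ up₂-qv lt ⟩
                q-up₂ (suc (D + m))    ≡⟨ cong q-up₂ (sym (+-suc D m)) ⟩
                q-up₂ (D + suc m)      ≡⟨ q-up₂-+ (suc m) ⟩
                pv (odd-ceil (suc m))  ≡⟨ cong pv (odd-ceil-odd (even⇒suc-odd {m} even)) ⟩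
                pv (suc m)             ∎))))
        where open ≡-Reasoning
      ...   | inj₂ (NQ≤ , e) = ⊥-elim (ne (trans e (sym (trans (cong pv (odd-ceil-even even)) (pv-≥ NP≤m+1)))))
        where
        NP≤m+1 : NP ≤ suc m
        NP≤m+1 = +-cancelˡ-≤ D NP (suc m) (≤-trans (<⇒≤ D+NP<NQ) (subst (NQ ≤_) (sym (+-suc D m)) NQ≤))
      uppers-adjacent-high m ne | inj₂ odd with pv-cases m
      ... | inj₁ (m< , _) = ne , inj₂ (inj₂ (sym (begin
                up₂ (pv (odd-ceil m))   ≡⟨ cong (up₂ ∘′ pv) (odd-ceil-odd odd) ⟩
                up₂ (pv m)              ≡⟨ up₂-pv m< ⟩
                qv (D + even-ceil m)    ≡⟨ cong (λ y → qv (D + y)) (even-ceil-odd odd) ⟩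
                qv (D + suc m)          ≡⟨ cong qv (+-suc D m) ⟩
                qv (suc (D + m))        ∎)))
        where open ≡-Reasoning
      ... | inj₂ (NP≤m , pm≡t) with qv-cases (suc (D + m))
      ...   | inj₂ (_ , e) = ⊥-elim (ne (trans e (sym (trans (cong pv (odd-ceil-odd odd)) pm≡t))))
      ...   | inj₁ (lt , _) = ne , inj₁ (inj₂ (begin
                pv (odd-ceil m)              ≡⟨ cong pv (odd-ceil-odd odd) ⟩
                pv m                         ≡⟨ pm≡t ⟩
                t                            ≡⟨ sym (pv-≥ (≤-trans NP≤m (≤-trans (n≤1+n m) (n≤1+n (suc m))))) ⟩
                pv (suc (suc m))             ≡⟨ cong pv (sym (odd-ceil-even (odd⇒suc-even {m} odd))) ⟩
                pv (odd-ceil (suc m))        ≡⟨ sym (q-up₂-+ (suc m)) ⟩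
                q-up₂ (D + suc m)            ≡⟨ cong q-up₂ (+-suc D m) ⟩
                q-up₂ (suc (D + m))          ≡⟨ sym (up₂-qv lt) ⟩
                up₂ (qv (suc (D + m)))       ∎))
        where open ≡-Reasoning

    uppers-adjacent : ∀ v → up₁ v ≢ up₂ v → Adj (up₁ v) (up₂ v)
    uppers-adjacent h ne = ne , inj₂ (inj₂ (sym (trans (up₂-pv 0<NP) (cong qv (+-identityʳ D)))))
    uppers-adjacent t ne = ⊥-elim (ne refl)
    uppers-adjacent (p i) ne with %2-cases (toℕ i)
    ... | inj₁ even = ne , inj₂ (inj₂ (sym (begin
            up₂ (qv (D + even-ceil k))  ≡⟨ up₂-qv (D+even-ceil<NQ (toℕ<n i) even) ⟩
            q-up₂ (D + even-ceil k)     ≡⟨ cong (λ y → q-up₂ (D + y)) (even-ceil-even even) ⟩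
            q-up₂ (D + k)               ≡⟨ q-up₂-+ k ⟩
            pv (odd-ceil k)             ≡⟨ cong pv (odd-ceil-even even) ⟩
            pv (suc k)                  ∎)))
      where
      k : ℕ
      k = toℕ i
      open ≡-Reasoning
    ... | inj₂ odd = ne , inj₁ (inj₂ (sym (trans (up₂-pv (odd⇒suc<NP (toℕ<n i) odd))
                       (cong (λ y → qv (D + y)) (trans (even-ceil-even (odd⇒suc-even {toℕ i} odd)) (sym (even-ceil-odd {toℕ i} odd)))))))
    uppers-adjacent (q j) ne with D-split (toℕ j)
    ... | inj₂ (m , j≡D+m) =
      subst₂ Adj (cong (qv ∘′ suc) (sym j≡D+m)) (sym (trans (cong q-up₂ j≡D+m) (q-up₂-+ m)))
        (uppers-adjacent-high m (subst₂ _≢_ (cong (qv ∘′ suc) j≡D+m) (trans (cong q-up₂ j≡D+m) (q-up₂-+ m)) ne))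
    ... | inj₁ j<D with m≤n⇒m<n∨m≡n j<D
    ...   | inj₁ j+1<D = ne , inj₁ (inj₂ (trans (q-up₂-< j<D) (sym (trans (up₂-qv (<-trans j+1<D D<NQ)) (q-up₂-< j+1<D)))))
    ...   | inj₂ j+1≡D = ne , inj₂ (inj₁ (trans (cong qv j+1≡D) (cong up₁ (sym (q-up₂-< j<D)))))

    later-neighbours-adjacent : ∀ v u w → T (adjacency v u) → T (adjacency v w) → rank v < rank u → rank v < rank w →
                                u ≢ w → T (adjacency u w)
    later-neighbours-adjacent v u w v~u v~w v<u v<w u≢w
      with higher-neighbour-above (toWitness v~u) v<u | higher-neighbour-above (toWitness v~w) v<w
    ... | inj₁ refl | inj₁ refl = ⊥-elim (u≢w refl)
    ... | inj₂ refl | inj₂ refl = ⊥-elim (u≢w refl)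
    ... | inj₁ refl | inj₂ refl = fromWitness (uppers-adjacent v u≢w)
    ... | inj₂ refl | inj₁ refl = fromWitness (Adj-sym (uppers-adjacent v (u≢w ∘′ sym)))

    chordal-adjacency : Chordal adjacency
    chordal-adjacency = Paths.EliminationOrdering.elimination⇒chordal adjacency adjacency-sym rank rank-injective later-neighbours-adjacent

    gadget-edges : ∀ u v → GadgetEdge u v → T (adjacency u v)
    gadget-edges _ _ (pp i i′ i′≡) = fromWitness ((λ eq → 1+n≢n (trans (sym i′≡) (cong toℕ (p-injective (sym eq))))) ,
                                      inj₁ (inj₁ (trans (sym (pv-toℕ i′)) (cong pv i′≡))))
      where
      p-injective : ∀ {i i′ : Fin NP} → p {n} {s} i ≡ p i′ → i ≡ i′
      p-injective refl = refl
    gadget-edges _ _ (qq j j′ j′≡) = fromWitness ((λ eq → 1+n≢n (trans (sym j′≡) (cong toℕ (q-injective (sym eq))))) ,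
                                      inj₁ (inj₁ (trans (sym (qv-toℕ j′)) (cong qv j′≡))))
      where
      q-injective : ∀ {j j′ : Fin NQ} → q {n} {s} j ≡ q j′ → j ≡ j′
      q-injective refl = refl
    gadget-edges _ _ (hp i i≡0) = fromWitness ((λ ()) , inj₁ (inj₂ (trans (sym (pv-toℕ i)) (cong pv i≡0))))
    gadget-edges _ _ (hq j j≡0) with D-split 0
    ... | inj₁ 0<D = fromWitness ((λ ()) , inj₂ (inj₂ (sym (trans (cong q-up₂ j≡0) (q-up₂-< 0<D)))))
    ... | inj₂ (m , 0≡D+m) = fromWitness ((λ ()) , inj₁ (inj₁ (trans (sym (qv-toℕ j)) (cong qv (trans j≡0 D≡0)))))
      where
      D≡0 : 0 ≡ D
      D≡0 = sym (m+n≡0⇒m≡0 D (sym 0≡D+m))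
    gadget-edges _ _ (tp i i+1≡) = fromWitness ((λ ()) , inj₂ (inj₁ (sym (trans (cong pv i+1≡) (pv-≥ ≤-refl)))))
    gadget-edges _ _ (tq j j+1≡) = fromWitness ((λ ()) , inj₂ (inj₁ (sym (trans (cong qv j+1≡) (qv-≥ ≤-refl)))))

    up₁-proper : ∀ {w col} → w ≢ up₁ w → HasColor w col → HasColor (up₁ w) col → ⊥
    up₁-proper {h} _ (here refl) has = Q-has-no-bP (qv-colours-< D<NQ has)
    up₁-proper {h} _ (there ()) _
    up₁-proper {t} t≢t _ _ = t≢t refl
    up₁-proper {p i} {col} _ has has′ with pv-colours {suc (toℕ i)} has′
    ... | inj₁ (_ , pc) =
      [ [1+x]%2≢x%2 (toℕ i) ∘′ sym
      , (λ eq → mod-4-apart (toℕ i) 1 ≤-refl (s≤s z≤n) (trans eq (cong (_% 4) (+-comm 1 (toℕ i))))) ]′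
                            (PColour-shared {toℕ i} {suc (toℕ i)} (p-colours {i} has) pc)
    ... | inj₂ (NP≤ , refl) with p-colours {i} has
    ...   | p-b _ odd = [1+x]%2≢x%2 (toℕ i) (trans (cong (_% 2) (≤-antisym (toℕ<n i) NP≤)) (trans NP-odd (sym odd)))
    ...   | p-a () _
    ...   | p-c ()
    up₁-proper {q j} {col} _ has has′ with qv-colours {suc (toℕ j)} has′
    ... | inj₁ (_ , qc) =
      [ [1+x]%2≢x%2 (toℕ j) ∘′ sym
      , (λ eq → mod-4-apart (toℕ j + 2) 1 ≤-refl (s≤s z≤n) (trans eq (cong (_% 4) (+-comm 1 (toℕ j + 2))))) ]′
                            (QColour-shared {toℕ j} {suc (toℕ j)} (q-colours {j} has) qc)
    ... | inj₂ refl = Q-has-no-bP (q-colours {j} has)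

    up₂-proper : ∀ {w col} → w ≢ up₂ w → HasColor w col → HasColor (up₂ w) col → ⊥
    up₂-proper {h} _ (here refl) has with pv-colours-< 0<NP has
    ... | p-a () _
    ... | p-b _ ()
    ... | p-c ()
    up₂-proper {h} _ (there ()) _
    up₂-proper {t} t≢t _ _ = t≢t refl
    up₂-proper {p i} _ has has′ =
      [ (λ (_ , l-odd) → 0≢1+n (trans (sym l-even) l-odd)) , k≢l+2 ]′ (PQColour-shared (p-colours {i} has) (qv-colours-< l< has′))
      where
      k l : ℕ
      k = toℕ i
      l = D + even-ceil k
      l-even : l % 2 ≡ 0
      l-even = trans ([4u+x]%2≡x%2 Δ (even-ceil k)) (even-ceil-is-even k)
      l+2≡ : (l + 2) % 4 ≡ (even-ceil k + 2) % 4
      l+2≡ = trans (cong (_% 4) (+-assoc D (even-ceil k) 2)) ([4u+x]%4≡x%4 Δ (even-ceil k + 2))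
      l< : l < NQ
      l< with %2-cases k
      ... | inj₁ even = D+even-ceil<NQ (toℕ<n i) even
      ... | inj₂ odd = subst (λ y → D + y < NQ) (sym (even-ceil-odd odd)) (<-trans (+-monoʳ-< D (odd⇒suc<NP (toℕ<n i) odd)) D+NP<NQ)
      k≢l+2 : k % 4 ≢ (l + 2) % 4
      k≢l+2 eq with %2-cases k
      ... | inj₁ even = mod-4-apart k 2 (s≤s z≤n) (s≤s (s≤s z≤n)) (trans eq (trans l+2≡ (cong (λ y → (y + 2) % 4) (even-ceil-even {k} even))))
      ... | inj₂ odd = mod-4-apart k 3 (s≤s z≤n) ≤-refl
                         (trans eq (trans l+2≡ (trans (cong (λ y → (y + 2) % 4) (even-ceil-odd {k} odd)) (cong (_% 4) (sym (+-suc k 2))))))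
    up₂-proper {q j} {col} _ has has′ with D-split (toℕ j)
    ... | inj₁ j<D = Q-has-no-bP (subst (QColour (toℕ j)) (h-colour (subst (λ u → HasColor u col) (q-up₂-< j<D) has′)) (q-colours {j} has))
      where
      h-colour : ∀ {col} → HasColor {n} {s} h col → col ≡ bP
      h-colour (here eq) = eq
    ... | inj₂ (m , j≡) with pv-colours {odd-ceil m} (subst (λ u → HasColor u col) (trans (cong q-up₂ j≡) (q-up₂-+ m)) has′)
    ...   | inj₂ (_ , refl) = Q-has-no-bP (q-colours {j} has)
    ...   | inj₁ (_ , pc) = [ (λ (even , _) → 0≢1+n (trans (sym even) (odd-ceil-is-odd m))) , apart ]′ (PQColour-shared pc (q-colours {j} has))
      where
      j+2≡ : (toℕ j + 2) % 4 ≡ (m + 2) % 4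
      j+2≡ = trans (cong (λ y → (y + 2) % 4) j≡) (trans (cong (_% 4) (+-assoc D m 2)) ([4u+x]%4≡x%4 Δ (m + 2)))
      apart : odd-ceil m % 4 ≢ (toℕ j + 2) % 4
      apart eq with %2-cases m
      ... | inj₁ even = mod-4-apart (suc m) 1 ≤-refl (s≤s z≤n)
                          (trans (cong (_% 4) (sym (odd-ceil-even {m} even))) (trans eq (trans j+2≡ (cong (_% 4) (+-suc m 1)))))
      ... | inj₂ odd = mod-4-apart m 2 (s≤s z≤n) (s≤s (s≤s z≤n)) (trans (cong (_% 4) (sym (odd-ceil-odd {m} odd))) (trans eq j+2≡))

    triangulation : Triangulation n s
    triangulation = record
      { adj = adjacency ; symm = adjacency-sym ; irrefl = adjacency-irrefl ; super = gadget-edges ; chordal = chordal-adjacency }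

    proper : ProperlyMulticolored triangulation
    proper u v u~v col has-u has-v with toWitness u~v
    ... | u≢v , inj₁ (inj₁ refl) = up₁-proper u≢v has-u has-v
    ... | u≢v , inj₁ (inj₂ refl) = up₂-proper u≢v has-u has-v
    ... | u≢v , inj₂ (inj₁ refl) = up₁-proper (u≢v ∘′ sym) has-v has-u
    ... | u≢v , inj₂ (inj₂ refl) = up₂-proper (u≢v ∘′ sym) has-v has-u

    first-tooth-locked : Locked triangulation 1 (1 + Δ)
    first-tooth-locked =
      p (fromℕ< 0<NP) , q (fromℕ< D<NQ) ,
      cong (λ k → suc (k / 4)) (toℕ-fromℕ< 0<NP) ,
      cong suc (trans (cong (_/ 4) (toℕ-fromℕ< D<NQ)) (trans (cong (_/ 4) (*-comm 4 Δ)) (m*n/n≡m Δ 4))) ,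
      fromWitness ((λ ()) , inj₁ (inj₂ (sym (trans (cong (λ k → qv (D + even-ceil k)) (toℕ-fromℕ< 0<NP))
                                                    (trans (cong qv (+-identityʳ D)) (qv-< D<NQ)))))) ,
      inj₁ (subst (λ u → HasColor u a) (pv-< 0<NP) (pv-colour 0<NP (p-a refl refl)))

    -- The forward direction yields some offset Δ′, and the locked pair above forces Δ′ = Δ.
    has-offset : HasOffset triangulation Δ
    has-offset = same-offset (Forward.forward triangulation proper)
      where
      same-offset : ∃[ Δ′ ] (Δ′ ≤ s × HasOffset triangulation Δ′) → HasOffset triangulation Δ
      same-offset (Δ′ , _ , offset′) =
        subst (HasOffset triangulation)
          (sym (suc-injective (proj₂ (offset′ 1 ≤-refl 1≤n) (1 + Δ) (s≤s z≤n) (+-mono-≤ 1≤n Δ≤s) first-tooth-locked))) offset′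

proposition4 : (n s : ℕ) → 1 ≤ n →
    ((G : Triangulation n s) → ProperlyMulticolored G →
       ∃[ Δ ] (Δ ≤ s × HasOffset G Δ))
    × ((Δ : ℕ) → Δ ≤ s →
       Σ (Triangulation n s) (λ G → ProperlyMulticolored G × HasOffset G Δ))
proposition4 n s 1≤n =
  (λ G proper → Forward.forward G proper) ,
  (λ Δ Δ≤s → Construction.triangulation Δ Δ≤s , Construction.proper Δ Δ≤s , Construction.has-offset Δ Δ≤s)
  where open Gadget n s 1≤n
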